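{- Let $G$ be a graph, $S\subseteq V(G)$, $f:S\to\mathbb{N}$ with $f(s)\geq 1$ for all $s\in S$, and let $M=M(S,f)$ be the multiset with support $S$ and multiplicities $f$. Let $\mathfrak{R}_2:=\{f(S'): S'\subseteq S,\ |S'|\geq 2\}$, where $f(S')=\sum_{s\in S'}f(s)$. For any collection of integers $\{c_i: i\in\mathfrak{R}_2\}$ there exists a graph $G'$ containing $G$ as an induced subgraph such that $\mathcal{E}(G';M,q)[q^k]=c_k$ for all $k\in\mathfrak{R}_2$.
   Context: Graphs are finite and simple; $N[X]$ is the closed neighborhood of $X$. Power domination process on a graph $H$ from $T\subseteq V(H)$: set $B:=N[T]$; then, while some $x\in B$ has exactly one vertex $y$ of $N[x]$ outside $B$, add $y$ to $B$. The final set is $\mathrm{Obs}(H;T)$ (with $\mathrm{Obs}(H;\emptyset)=\emptyset$). For a multiset placement $M=M(S,f)$ (multiplicity $f(s)$ at $s$, each of the $f(s)$ sensors failing independently with probability $q\in[0,1]$), the expected value polynomial is $\mathcal{E}(H;M,q)=\sum_{S'\subseteq S}|\mathrm{Obs}(H;S')|\,q^{f(S\setminus S')}\prod_{s\in S'}(1-q^{f(s)})$, the expected number of observed vertices. For a polynomial $p$ in $q$, $p[q^j]$ denotes the coefficient of $q^j$. -}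

module Defs where

open import Data.Nat using (ℕ; zero; suc; _+_; _≤_)
open import Data.Integer as ℤ using (ℤ; +_; -_)
open import Data.Bool using (Bool; true; false; _∧_; _∨_; not; if_then_else_)
open import Data.Fin using (Fin; zero; suc; _≟_; splitAt; _↑ˡ_)
open import Data.Sum using ([_,_]′)
open import Data.List using (List; []; _∷_; map; _++_; replicate; foldr)
open import Relation.Nullary.Decidable using (⌊_⌋)
open import Relation.Binary.PropositionalEquality using (_≡_)
open import Function using (_∘_; const)

record Graph (n : ℕ) : Set where
  field
    adj    : Fin n → Fin n → Bool
    sym    : ∀ u v → adj u v ≡ adj v u
    irrefl : ∀ v → adj v v ≡ false
open Graph public

VSet : ℕ → Set
VSet n = Fin n → Bool

_⊆ᵥ_ : ∀ {n} → VSet n → VSet n → Set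
A ⊆ᵥ B = ∀ v → A v ≡ true → B v ≡ true

anyF : ∀ {n} → (Fin n → Bool) → Bool
anyF {zero}  p = false
anyF {suc n} p = p zero ∨ anyF (p ∘ suc)

card : ∀ {n} → (Fin n → Bool) → ℕ
card {zero}  p = 0
card {suc n} p = (if p zero then 1 else 0) + card (p ∘ suc)

fsum : ∀ {n} → (Fin n → ℕ) → VSet n → ℕ
fsum {zero}  f A = 0
fsum {suc n} f A = (if A zero then f zero else 0) + fsum (f ∘ suc) (A ∘ suc)

cnbr : ∀ {n} → Graph n → Fin n → Fin n → Bool
cnbr G x v = ⌊ x ≟ v ⌋ ∨ adj G x v

closedN : ∀ {n} → Graph n → VSet n → VSet n
closedN G T v = anyF (λ t → T t ∧ cnbr G t v)

propStep : ∀ {n} → Graph n → VSet n → VSet n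
propStep G B y = B y ∨ anyF (λ x → B x ∧ cnbr G x y ∧
                   ⌊ card (λ w → cnbr G x w ∧ not (B w)) Data.Nat.≟ 1 ⌋)

iter : ∀ {A : Set} → ℕ → (A → A) → A → A
iter zero    h a = a
iter (suc k) h a = h (iter k h a)

-- Obs(G;T): the propagation stabilises after at most n rounds
Obs : ∀ {n} → Graph n → VSet n → VSet n
Obs {n} G T = iter n (propStep G) (closedN G T)

-- Integer polynomials in q as coefficient lists (constant term first)

Poly : Set
Poly = List ℤ

_⊕_ : Poly → Poly → Poly
[]      ⊕ q       = q
(a ∷ p) ⊕ []      = a ∷ p
(a ∷ p) ⊕ (b ∷ q) = (a ℤ.+ b) ∷ (p ⊕ q)

_⊗_ : Poly → Poly → Poly
[]      ⊗ q = []
(a ∷ p) ⊗ q = map (a ℤ.*_) q ⊕ (+ 0 ∷ (p ⊗ q))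

constP : ℤ → Poly
constP a = a ∷ []

qPow : ℕ → Poly
qPow k = replicate k (+ 0) ++ (+ 1 ∷ [])

oneMinusQPow : ℕ → Poly
oneMinusQPow k = constP (+ 1) ⊕ map -_ (qPow k)

coeff : Poly → ℕ → ℤ
coeff []      j       = + 0
coeff (a ∷ p) zero    = a
coeff (a ∷ p) (suc j) = coeff p j

subsetsOf : ∀ {n} → VSet n → List (VSet n)
subsetsOf {zero}  S = (λ ()) ∷ []
subsetsOf {suc n} S =
  map (extV false) (subsetsOf (S ∘ suc))
    ++ (if S zero then map (extV true) (subsetsOf (S ∘ suc)) else [])
  where
  extV : Bool → VSet n → VSet (suc n)
  extV b A zero    = b
  extV b A (suc i) = A i

prodOneMinus : ∀ {n} → (Fin n → ℕ) → VSet n → Poly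
prodOneMinus {zero}  f A = constP (+ 1)
prodOneMinus {suc n} f A =
  (if A zero then oneMinusQPow (f zero) else constP (+ 1))
    ⊗ prodOneMinus (f ∘ suc) (A ∘ suc)

expectedObs : ∀ {n} → Graph n → VSet n → (Fin n → ℕ) → Poly
expectedObs G S f =
  foldr (λ S' acc →
          ((constP (+ card (Obs G S')) ⊗ qPow (fsum f (λ v → S v ∧ not (S' v))))
             ⊗ prodOneMinus f S') ⊕ acc)
        [] (subsetsOf S)

IsInducedExt : ∀ {n m} → Graph n → Graph (n + m) → Set
IsInducedExt {n} {m} G G' =
  ∀ u v → adj G' (u ↑ˡ m) (v ↑ˡ m) ≡ adj G u v

liftSet : ∀ {n} m → VSet n → VSet (n + m)
liftSet {n} m S v = [ S , const false ]′ (splitAt n v)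

liftMult : ∀ {n} m → (Fin n → ℕ) → Fin (n + m) → ℕ
liftMult {n} m f v = [ f , const 0 ]′ (splitAt n v)

-- The extension of G attaches two leaves to every vertex of S, so that a vertex all of whose sensors failed
-- can never force, and a list of gadgets. When the working sensors sit at W, a gadget with taps A ⊆ S rooted
-- at r adds |A ∩ W| + [r ∈ W] + [A ∩ W ≠ ∅ ∧ r ∈ W] observed vertices (an unrooted one |A ∩ W| + [A ∩ W ≠ ∅]),
-- the last term through a tap forcing the sink, while propagation inside G only loses the blocked vertices.
-- All sensors on X fail with probability q^{f(X)}, so [X ∩ W ≠ ∅] has expectation 1 − q^{f(X)}. For T ⊆ S
-- with |T| ≥ 2 and r ∈ T, the unrooted gadget on T therefore contributes −q^{f(T)} and, by inclusion–exclusion,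
-- the gadget on T ∖ {r} rooted at r contributes +q^{f(T)}, both up to terms of degree < f(T) since f ≥ 1.
-- Adding copies of these gadgets degree by degree from the top down fixes every coefficient f(T) without
-- disturbing the ones above it.

module Submission where

open import Defs hiding (sym)

open import Data.Nat as ℕ using (ℕ; zero; suc; _+_; _*_; _≤_; _<_; z≤n; s≤s)
import Data.Nat.Properties as ℕP
open import Data.Nat.ListAction using (sum)
open import Data.Integer as ℤ using (ℤ; +_; -_; _-_; -1ℤ; -[1+_])
import Data.Integer.Properties as ℤP
open import Data.Integer.Solver using (module +-*-Solver)
open import Data.Bool as Bool using (Bool; true; false; _∧_; _∨_; not; if_then_else_)
open import Data.Bool.Properties using (¬-not; ∨-assoc; ∧-zeroʳ; ∨-comm; ∨-idem; ∨-identityʳ; ∧-comm; ∧-identityʳ)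
open import Data.Fin as Fin using (Fin; zero; suc; _↑ˡ_; _↑ʳ_; splitAt; join; remQuot; combine)
import Data.Fin.Properties as FinP
open import Data.Fin.Subset.Properties using (anySubset?)
import Data.Vec as Vec
open import Data.Vec.Properties using (lookup∘tabulate)
open import Data.List using (List; []; _∷_; map; _++_; foldr; length; lookup; replicate)
open import Data.List.Properties using (map-cong)
open import Data.Product using (Σ; ∃; _,_; proj₁; proj₂; _×_; uncurry)
open import Data.Sum using (_⊎_; inj₁; inj₂; [_,_]′)
open import Function using (_∘_; const)
open import Relation.Nullary using (yes; no; contradiction)
open import Relation.Nullary.Decidable using (⌊_⌋; Dec; _×-dec_; _→-dec_; map′)
open import Relation.Binary.PropositionalEquality
open import Algebra.Properties.CommutativeSemigroup ℕP.+-commutativeSemigroup using (x∙yz≈y∙xz)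

private
  variable
    n m : ℕ

∧-intro : ∀ {a b} → a ≡ true → b ≡ true → a ∧ b ≡ true
∧-intro refl refl = refl

∧-elim : ∀ a {b} → a ∧ b ≡ true → a ≡ true × b ≡ true
∧-elim true h = refl , h

∨-introˡ : ∀ {a} b → a ≡ true → a ∨ b ≡ true
∨-introˡ b refl = refl

∨-introʳ : ∀ a {b} → b ≡ true → a ∨ b ≡ true
∨-introʳ true  _ = refl
∨-introʳ false h = h

∨-elim : ∀ a {b} → a ∨ b ≡ true → a ≡ true ⊎ b ≡ true
∨-elim true  _ = inj₁ refl
∨-elim false h = inj₂ h

⇔⇒≡ : ∀ {a b} → (a ≡ true → b ≡ true) → (b ≡ true → a ≡ true) → a ≡ b
⇔⇒≡ {true}  to _    = sym (to refl)
⇔⇒≡ {false} {true} _ from = from refl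
⇔⇒≡ {false} {false} _ _ = refl

infixr 1 _⇒ᵇ_
_⇒ᵇ_ : Bool → Bool → Bool
a ⇒ᵇ b = not a ∨ b

⇒ᵇ-intro : ∀ a {b} → (a ≡ true → b ≡ true) → (a ⇒ᵇ b) ≡ true
⇒ᵇ-intro true  a→b = a→b refl
⇒ᵇ-intro false _   = refl

⇒ᵇ-elim : ∀ {a b} → (a ⇒ᵇ b) ≡ true → a ≡ true → b ≡ true
⇒ᵇ-elim a⇒b refl = a⇒b

not-true : ∀ {a} → not a ≡ true → a ≡ false
not-true {false} _ = refl

≟-sound : ∀ {a b} → ⌊ a ℕ.≟ b ⌋ ≡ true → a ≡ b
≟-sound {a} {b} h with a ℕ.≟ b
... | yes a≡b = a≡b

≟-complete : ∀ {a b} → a ≡ b → ⌊ a ℕ.≟ b ⌋ ≡ true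
≟-complete {a} refl with a ℕ.≟ a
... | yes _   = refl
... | no a≢a = contradiction refl a≢a

infix 4 _==_
_==_ : Fin n → Fin n → Bool
a == b = ⌊ a Fin.≟ b ⌋

==-refl : (a : Fin n) → (a == a) ≡ true
==-refl a with a Fin.≟ a
... | yes _   = refl
... | no a≢a = contradiction refl a≢a

==-false : {a b : Fin n} → a ≢ b → (a == b) ≡ false
==-false {a = a} {b} a≢b with a Fin.≟ b
... | yes a≡b = contradiction a≡b a≢b
... | no _    = refl

==-sound : {a b : Fin n} → (a == b) ≡ true → a ≡ b
==-sound {a = a} {b} h with a Fin.≟ b
... | yes a≡b = a≡b

anyF-intro : (p : Fin n → Bool) (x : Fin n) → p x ≡ true → anyF p ≡ true
anyF-intro p zero    px rewrite px = refl
anyF-intro p (suc x) px = ∨-introʳ (p zero) (anyF-intro (p ∘ suc) x px)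

anyF-elim : (p : Fin n → Bool) → anyF p ≡ true → ∃ λ x → p x ≡ true
anyF-elim {suc n} p h with ∨-elim (p zero) h
... | inj₁ p0 = zero , p0
... | inj₂ ps = let x , px = anyF-elim (p ∘ suc) ps in suc x , px

anyF-cong : {p q : Fin n → Bool} → p ≗ q → anyF p ≡ anyF q
anyF-cong {zero}  _   = refl
anyF-cong {suc n} p≗q = cong₂ _∨_ (p≗q zero) (anyF-cong (p≗q ∘ suc))

anyF-false : (p : Fin n → Bool) → (∀ x → p x ≡ false) → anyF p ≡ false
anyF-false {zero}  _ _ = refl
anyF-false {suc n} p none rewrite none zero = anyF-false (p ∘ suc) (none ∘ suc)

anyF-== : (W : VSet n) (w : Fin n) (c : Bool) → anyF (λ v → W v ∧ ((v == w) ∧ c)) ≡ W w ∧ c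
anyF-== W w c = ⇔⇒≡ to (λ Wc → let Ww , c′ = ∧-elim (W w) Wc in anyF-intro _ w (∧-intro Ww (∧-intro (==-refl w) c′)))
  where
  to : anyF (λ v → W v ∧ ((v == w) ∧ c)) ≡ true → W w ∧ c ≡ true
  to h with anyF-elim _ h
  ... | v , pv with ∧-elim (W v) pv
  ...   | Wv , rest with ∧-elim (v == w) rest
  ...     | v=w , c′ rewrite ==-sound v=w = ∧-intro Wv c′

anyF-splitAt : ∀ n (p : Fin (n + m) → Bool) → anyF p ≡ anyF (p ∘ (_↑ˡ m)) ∨ anyF (p ∘ (n ↑ʳ_))
anyF-splitAt zero    p = refl
anyF-splitAt (suc n) p = trans (cong (p zero ∨_) (anyF-splitAt n (p ∘ suc))) (sym (∨-assoc (p zero) _ _))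

card-cong : {p q : Fin n → Bool} → p ≗ q → card p ≡ card q
card-cong {zero}  _   = refl
card-cong {suc n} p≗q = cong₂ _+_ (cong (λ b → if b then 1 else 0) (p≗q zero)) (card-cong (p≗q ∘ suc))

card-false : (p : Fin n → Bool) → (∀ x → p x ≡ false) → card p ≡ 0
card-false {zero}  _ _ = refl
card-false {suc n} p none rewrite none zero = card-false (p ∘ suc) (none ∘ suc)

card-true : card {n} (λ _ → true) ≡ n
card-true {zero}  = refl
card-true {suc n} = cong suc (card-true {n})

card-≤ : (p : Fin n → Bool) → card p ≤ n
card-≤ {zero}  p = z≤n
card-≤ {suc n} p with p zero
... | true  = s≤s (card-≤ (p ∘ suc))
... | false = ℕP.m≤n⇒m≤1+n (card-≤ (p ∘ suc))

card-splitAt : ∀ n (p : Fin (n + m) → Bool) → card p ≡ card (p ∘ (_↑ˡ m)) + card (p ∘ (n ↑ʳ_))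
card-splitAt zero    p = refl
card-splitAt (suc n) p = trans (cong ((if p zero then 1 else 0) ℕ.+_) (card-splitAt n (p ∘ suc)))
                               (sym (ℕP.+-assoc (if p zero then 1 else 0) _ _))

card-mono : (p q : Fin n → Bool) → p ⊆ᵥ q → card p ≤ card q
card-mono {zero}  p q p⊆q = z≤n
card-mono {suc n} p q p⊆q with p zero in p0 | q zero in q0
... | true  | true  = s≤s (card-mono (p ∘ suc) (q ∘ suc) (p⊆q ∘ suc))
... | true  | false = contradiction (trans (sym (p⊆q zero p0)) q0) λ ()
... | false | true  = ℕP.m≤n⇒m≤1+n (card-mono (p ∘ suc) (q ∘ suc) (p⊆q ∘ suc))
... | false | false = card-mono (p ∘ suc) (q ∘ suc) (p⊆q ∘ suc)

⊆∧card≡⇒⊇ : (p q : Fin n → Bool) → p ⊆ᵥ q → card p ≡ card q →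
              ∀ x → q x ≡ true → p x ≡ true
⊆∧card≡⇒⊇ {suc n} p q p⊆q eq x qx with p zero in p0 | q zero in q0
⊆∧card≡⇒⊇ p q p⊆q eq zero    qx | true  | _     = p0
⊆∧card≡⇒⊇ p q p⊆q eq (suc x) qx | true  | true  =
  ⊆∧card≡⇒⊇ (p ∘ suc) (q ∘ suc) (p⊆q ∘ suc) (ℕP.suc-injective eq) x qx
⊆∧card≡⇒⊇ p q p⊆q eq x       qx | true  | false = contradiction (trans (sym (p⊆q zero p0)) q0) λ ()
⊆∧card≡⇒⊇ p q p⊆q eq x       qx | false | true  =
  contradiction eq (ℕP.<⇒≢ (s≤s (card-mono (p ∘ suc) (q ∘ suc) (p⊆q ∘ suc))))
⊆∧card≡⇒⊇ p q p⊆q eq zero    qx | false | false = contradiction (trans (sym qx) q0) λ ()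
⊆∧card≡⇒⊇ p q p⊆q eq (suc x) qx | false | false = ⊆∧card≡⇒⊇ (p ∘ suc) (q ∘ suc) (p⊆q ∘ suc) eq x qx

card-≥1 : (p : Fin n → Bool) (x : Fin n) → p x ≡ true → 1 ≤ card p
card-≥1 p zero    px rewrite px = s≤s z≤n
card-≥1 p (suc x) px = ℕP.≤-trans (card-≥1 (p ∘ suc) x px) (ℕP.m≤n+m _ (if p zero then 1 else 0))

card-≥2 : (p : Fin n → Bool) (x y : Fin n) → x ≢ y → p x ≡ true → p y ≡ true → 2 ≤ card p
card-≥2 p zero    zero    x≢y _  _  = contradiction refl x≢y
card-≥2 p zero    (suc y) _   px py rewrite px = s≤s (card-≥1 (p ∘ suc) y py)
card-≥2 p (suc x) zero    _   px py rewrite py = s≤s (card-≥1 (p ∘ suc) x px)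
card-≥2 p (suc x) (suc y) x≢y px py =
  ℕP.≤-trans (card-≥2 (p ∘ suc) x y (x≢y ∘ cong suc) px py) (ℕP.m≤n+m _ (if p zero then 1 else 0))

card-≡1 : (p : Fin n → Bool) (x : Fin n) → p x ≡ true → (∀ y → p y ≡ true → y ≡ x) → card p ≡ 1
card-≡1 p zero    px only rewrite px =
  cong suc (card-false (p ∘ suc) λ y → ¬-not λ py → FinP.0≢1+n (sym (only (suc y) py)))
card-≡1 p (suc x) px only with p zero in p0
... | true  = contradiction (only zero p0) FinP.0≢1+n
... | false = card-≡1 (p ∘ suc) x px λ y py → FinP.suc-injective (only (suc y) py)

card-≥1⇒∃ : (p : Fin n → Bool) → 1 ≤ card p → ∃ λ x → p x ≡ true
card-≥1⇒∃ {suc n} p h with p zero in p0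
... | true  = zero , p0
... | false = let x , px = card-≥1⇒∃ (p ∘ suc) h in suc x , px

card-partition : (p q : Fin n → Bool) → card p ≡ card (λ v → p v ∧ q v) + card (λ v → p v ∧ not (q v))
card-partition {zero}  p q = refl
card-partition {suc n} p q with p zero | q zero
... | true  | true  = cong suc (card-partition (p ∘ suc) (q ∘ suc))
... | true  | false = trans (cong suc (card-partition (p ∘ suc) (q ∘ suc))) (sym (ℕP.+-suc _ _))
... | false | _     = card-partition (p ∘ suc) (q ∘ suc)

card-[,]∘splitAt : ∀ {A : Set} n (h : A → Bool) (d₁ : Fin n → A) (d₂ : Fin m → A) →
                   card (λ z → h ([ d₁ , d₂ ]′ (splitAt n z))) ≡ card (h ∘ d₁) + card (h ∘ d₂)
card-[,]∘splitAt {m} n h d₁ d₂ = trans (card-splitAt n _)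
  (cong₂ _+_ (card-cong λ x → cong (h ∘ [ d₁ , d₂ ]′) (FinP.splitAt-↑ˡ n x m))
             (card-cong λ y → cong (h ∘ [ d₁ , d₂ ]′) (FinP.splitAt-↑ʳ n m y)))

card-remQuot : ∀ {A : Set} (gs : List A) k (p : A → Fin k → Bool) →
               card (uncurry (p ∘ lookup gs) ∘ remQuot k) ≡ sum (map (card ∘ p) gs)
card-remQuot []       k p = refl
card-remQuot (g ∷ gs) k p = trans (card-splitAt k _) (cong₂ _+_ (card-cong first) (trans (card-cong rest) (card-remQuot gs k p)))
  where
  first : ∀ z → uncurry (p ∘ lookup (g ∷ gs)) (remQuot k (z ↑ˡ length gs * k)) ≡ p g z
  first z rewrite FinP.splitAt-↑ˡ k z (length gs * k) = refl
  rest : ∀ y → uncurry (p ∘ lookup (g ∷ gs)) (remQuot k (k ↑ʳ y)) ≡ uncurry (p ∘ lookup gs) (remQuot k y)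
  rest y rewrite FinP.splitAt-↑ʳ k (length gs * k) y = refl

fsum-cong : (f : Fin n → ℕ) {A B : VSet n} → A ≗ B → fsum f A ≡ fsum f B
fsum-cong {zero}  f _   = refl
fsum-cong {suc n} f A≗B = cong₂ _+_ (cong (λ b → if b then f zero else 0) (A≗B zero)) (fsum-cong (f ∘ suc) (A≗B ∘ suc))

fsum-∅ : (f : Fin n → ℕ) → fsum f (λ _ → false) ≡ 0
fsum-∅ {zero}  f = refl
fsum-∅ {suc n} f = fsum-∅ (f ∘ suc)

fsum-singleton : (f : Fin n → ℕ) (X : VSet n) (x : Fin n) → X x ≡ true → (∀ y → X y ≡ true → y ≡ x) →
                 fsum f X ≡ f x
fsum-singleton f X zero    Xx only rewrite Xx =
  trans (cong (f zero ℕ.+_) (trans (fsum-cong (f ∘ suc) {B = λ _ → false}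
                                   λ y → ¬-not λ Xy → FinP.0≢1+n (sym (only (suc y) Xy)))
                                 (fsum-∅ (f ∘ suc))))
        (ℕP.+-identityʳ _)
fsum-singleton f X (suc x) Xx only with X zero in X0
... | true  = contradiction (only zero X0) FinP.0≢1+n
... | false = fsum-singleton (f ∘ suc) (X ∘ suc) x Xx λ y Xy → FinP.suc-injective (only (suc y) Xy)

fsum-partition : (f : Fin n → ℕ) (A C : VSet n) →
                 fsum f A ≡ fsum f (λ v → A v ∧ C v) + fsum f (λ v → A v ∧ not (C v))
fsum-partition {zero}  f A C = refl
fsum-partition {suc n} f A C with A zero | C zero
... | true  | true  = trans (cong (f zero ℕ.+_) (fsum-partition (f ∘ suc) (A ∘ suc) (C ∘ suc)))
                            (sym (ℕP.+-assoc (f zero) _ _))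
... | true  | false = trans (cong (f zero ℕ.+_) (fsum-partition (f ∘ suc) (A ∘ suc) (C ∘ suc)))
                            (x∙yz≈y∙xz (f zero) (fsum (f ∘ suc) (λ v → A (suc v) ∧ C (suc v))) _)
... | false | _     = fsum-partition (f ∘ suc) (A ∘ suc) (C ∘ suc)

fsum-≥ : (f : Fin n → ℕ) (A : VSet n) (x : Fin n) → A x ≡ true → f x ≤ fsum f A
fsum-≥ f A zero    Ax rewrite Ax = ℕP.m≤m+n (f zero) _
fsum-≥ f A (suc x) Ax = ℕP.≤-trans (fsum-≥ (f ∘ suc) (A ∘ suc) x Ax) (ℕP.m≤n+m _ (if A zero then f zero else 0))

fsum-mono : (f : Fin n → ℕ) (A B : VSet n) → A ⊆ᵥ B → fsum f A ≤ fsum f B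
fsum-mono {zero}  f A B A⊆B = z≤n
fsum-mono {suc n} f A B A⊆B with A zero in A0 | B zero in B0
... | true  | true  = ℕP.+-monoʳ-≤ (f zero) (fsum-mono (f ∘ suc) (A ∘ suc) (B ∘ suc) (A⊆B ∘ suc))
... | true  | false = contradiction (trans (sym (A⊆B zero A0)) B0) λ ()
... | false | true  = ℕP.≤-trans (fsum-mono (f ∘ suc) (A ∘ suc) (B ∘ suc) (A⊆B ∘ suc)) (ℕP.m≤n+m _ (f zero))
... | false | false = fsum-mono (f ∘ suc) (A ∘ suc) (B ∘ suc) (A⊆B ∘ suc)

propStep-cong : ∀ {N} (H : Graph N) {A B : VSet N} → A ≗ B → propStep H A ≗ propStep H B
propStep-cong H A≗B y = cong₂ _∨_ (A≗B y) (anyF-cong λ x →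
  cong₂ (λ a k → a ∧ (cnbr H x y ∧ ⌊ k ℕ.≟ 1 ⌋)) (A≗B x)
        (card-cong λ w → cong (λ b → cnbr H x w ∧ not b) (A≗B w)))

iter-cong : ∀ {N} (F : VSet N → VSet N) → (∀ {A B} → A ≗ B → F A ≗ F B) →
            ∀ t {A B} → A ≗ B → iter t F A ≗ iter t F B
iter-cong F F-cong zero    A≗B = A≗B
iter-cong F F-cong (suc t) A≗B = F-cong (iter-cong F F-cong t A≗B)

Obs-cong : ∀ {N} (H : Graph N) {A B : VSet N} → A ≗ B → Obs H A ≗ Obs H B
Obs-cong {N} H A≗B =
  iter-cong (propStep H) (propStep-cong H) N λ y → anyF-cong λ t → cong (_∧ cnbr H t y) (A≗B t)

module _ (F : VSet n → VSet n) (F-cong : ∀ {A B} → A ≗ B → F A ≗ F B)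
         (F-inflationary : ∀ A → A ⊆ᵥ F A) where

  Fixed : VSet n → Set
  Fixed A = F A ≗ A

  -- each round that does not reach a fixed point adds a vertex
  fixed-or-large : ∀ A t → Fixed (iter t F A) ⊎ t ≤ card (iter t F A)
  fixed-or-large A zero = inj₂ z≤n
  fixed-or-large A (suc t) with fixed-or-large A t
  ... | inj₁ fixed = inj₁ (F-cong fixed)
  ... | inj₂ t≤card with card (F (iter t F A)) ℕ.≟ card (iter t F A)
  ...   | yes same = inj₁ (F-cong fixed)
    where
    fixed : Fixed (iter t F A)
    fixed v = ⇔⇒≡ (⊆∧card≡⇒⊇ _ _ (F-inflationary _) (sym same) v) (F-inflationary _ v)
  ...   | no grows = inj₂ (ℕP.≤-trans (s≤s t≤card)
                                      (ℕP.≤∧≢⇒< (card-mono _ _ (F-inflationary _)) (grows ∘ sym)))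

  iter-fixed : ∀ A → Fixed (iter n F A)
  iter-fixed A with fixed-or-large A n
  ... | inj₁ fixed = fixed
  ... | inj₂ n≤card = λ v → trans (F-cong full v) (trans (F-inflationary _ v refl) (sym (full v)))
    where
    full : ∀ v → iter n F A v ≡ true
    full v = ⊆∧card≡⇒⊇ _ (λ _ → true) (λ _ _ → refl)
               (trans (ℕP.≤-antisym (card-≤ _) n≤card) (sym card-true)) v refl

  iter-stable : ∀ A k → iter (n + k) F A ≗ iter n F A
  iter-stable A zero    rewrite ℕP.+-identityʳ n = λ _ → refl
  iter-stable A (suc k) rewrite ℕP.+-suc n k = λ v → trans (F-cong (iter-stable A k) v) (iter-fixed A v)

-- a propagation round in G in which sensor vertices whose sensors all failed do not force
guardedStep : Graph n → VSet n → VSet n → VSet n → VSet n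
guardedStep G S W B y =
  B y ∨ anyF (λ x → B x ∧ (cnbr G x y ∧ ((S x ⇒ᵇ W x) ∧ ⌊ card (λ w → cnbr G x w ∧ not (B w)) ℕ.≟ 1 ⌋)))

guardedStep-cong : (G : Graph n) (S W : VSet n) {A B : VSet n} → A ≗ B → guardedStep G S W A ≗ guardedStep G S W B
guardedStep-cong G S W A≗B y = cong₂ _∨_ (A≗B y) (anyF-cong λ x →
  cong₂ (λ a k → a ∧ (cnbr G x y ∧ ((S x ⇒ᵇ W x) ∧ ⌊ k ℕ.≟ 1 ⌋))) (A≗B x)
        (card-cong λ w → cong (λ b → cnbr G x w ∧ not b) (A≗B w)))

guardedStep-inflationary : (G : Graph n) (S W B : VSet n) → B ⊆ᵥ guardedStep G S W B
guardedStep-inflationary G S W B v Bv = ∨-introˡ _ Bv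

-- Coefficients of polynomials in q

-- δ a and shift a F are the coefficient sequences of q^a and of q^a · F
δ : ℕ → ℕ → ℤ
δ zero    zero    = + 1
δ zero    (suc j) = + 0
δ (suc a) zero    = + 0
δ (suc a) (suc j) = δ a j

shift : ℕ → (ℕ → ℤ) → ℕ → ℤ
shift zero    F j       = F j
shift (suc a) F zero    = + 0
shift (suc a) F (suc j) = shift a F j

δ-refl : ∀ a → δ a a ≡ + 1
δ-refl zero    = refl
δ-refl (suc a) = δ-refl a

δ-< : ∀ {a j} → a < j → δ a j ≡ + 0
δ-< {zero}  {suc j} _         = refl
δ-< {suc a} {suc j} (s≤s a<j) = δ-< a<j

shift-cong : ∀ a {F G : ℕ → ℤ} → F ≗ G → shift a F ≗ shift a G
shift-cong zero    F≗G j       = F≗G j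
shift-cong (suc a) F≗G zero    = refl
shift-cong (suc a) F≗G (suc j) = shift-cong a F≗G j

shift-+ : ∀ a b F → shift (a + b) F ≗ shift a (shift b F)
shift-+ zero    b F j       = refl
shift-+ (suc a) b F zero    = refl
shift-+ (suc a) b F (suc j) = shift-+ a b F j

shift-comm : ∀ a b F → shift a (shift b F) ≗ shift b (shift a F)
shift-comm a b F j = begin
  shift a (shift b F) j ≡⟨ shift-+ a b F j ⟨
  shift (a + b) F j     ≡⟨ cong (λ k → shift k F j) (ℕP.+-comm a b) ⟩
  shift (b + a) F j     ≡⟨ shift-+ b a F j ⟩
  shift b (shift a F) j ∎
  where open ≡-Reasoning

shift-δ : ∀ a b → shift a (δ b) ≗ δ (a + b)
shift-δ zero    b j       = refl
shift-δ (suc a) b zero    = refl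
shift-δ (suc a) b (suc j) = shift-δ a b j

shift-− : ∀ a F G → shift a (λ i → F i - G i) ≗ λ i → shift a F i - shift a G i
shift-− zero    F G j       = refl
shift-− (suc a) F G zero    = refl
shift-− (suc a) F G (suc j) = shift-− a F G j

shift-0 : ∀ a → shift a (λ _ → + 0) ≗ λ _ → + 0
shift-0 zero    j       = refl
shift-0 (suc a) zero    = refl
shift-0 (suc a) (suc j) = shift-0 a j

open +-*-Solver using (solve; _:+_; _:*_; :-_; _:-_; _:=_; con)

coeff-⊕ : ∀ p q → coeff (p ⊕ q) ≗ λ j → coeff p j ℤ.+ coeff q j
coeff-⊕ []      q       j       = sym (ℤP.+-identityˡ _)
coeff-⊕ (a ∷ p) []      j       = sym (ℤP.+-identityʳ _)
coeff-⊕ (a ∷ p) (b ∷ q) zero    = refl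
coeff-⊕ (a ∷ p) (b ∷ q) (suc j) = coeff-⊕ p q j

coeff-scale : ∀ c p → coeff (map (c ℤ.*_) p) ≗ λ j → c ℤ.* coeff p j
coeff-scale c []      j       = sym (ℤP.*-zeroʳ c)
coeff-scale c (a ∷ p) zero    = refl
coeff-scale c (a ∷ p) (suc j) = coeff-scale c p j

coeff-∷-⊗ : ∀ a p Y → coeff ((a ∷ p) ⊗ Y) ≗ λ j → a ℤ.* coeff Y j ℤ.+ shift 1 (coeff (p ⊗ Y)) j
coeff-∷-⊗ a p Y zero    = trans (coeff-⊕ (map (a ℤ.*_) Y) _ zero) (cong (ℤ._+ + 0) (coeff-scale a Y zero))
coeff-∷-⊗ a p Y (suc j) = trans (coeff-⊕ (map (a ℤ.*_) Y) _ (suc j)) (cong (ℤ._+ _) (coeff-scale a Y (suc j)))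

coeff-⊕-⊗ : ∀ p q Y → coeff ((p ⊕ q) ⊗ Y) ≗ λ j → coeff (p ⊗ Y) j ℤ.+ coeff (q ⊗ Y) j
coeff-⊕-⊗ []      q       Y j = sym (ℤP.+-identityˡ _)
coeff-⊕-⊗ (a ∷ p) []      Y j = sym (ℤP.+-identityʳ _)
coeff-⊕-⊗ (a ∷ p) (b ∷ q) Y zero
  rewrite coeff-∷-⊗ (a ℤ.+ b) (p ⊕ q) Y zero | coeff-∷-⊗ a p Y zero | coeff-∷-⊗ b q Y zero =
  solve 3 (λ a b y → (a :+ b) :* y :+ con (+ 0) := (a :* y :+ con (+ 0)) :+ (b :* y :+ con (+ 0)))
        refl a b (coeff Y zero)
coeff-⊕-⊗ (a ∷ p) (b ∷ q) Y (suc j)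
  rewrite coeff-∷-⊗ (a ℤ.+ b) (p ⊕ q) Y (suc j) | coeff-∷-⊗ a p Y (suc j) | coeff-∷-⊗ b q Y (suc j)
        | coeff-⊕-⊗ p q Y j =
  solve 5 (λ a b y u v → (a :+ b) :* y :+ (u :+ v) := (a :* y :+ u) :+ (b :* y :+ v))
        refl a b (coeff Y (suc j)) (coeff (p ⊗ Y) j) (coeff (q ⊗ Y) j)

coeff-scale-⊗ : ∀ c p Y → coeff (map (c ℤ.*_) p ⊗ Y) ≗ λ j → c ℤ.* coeff (p ⊗ Y) j
coeff-scale-⊗ c []      Y j = sym (ℤP.*-zeroʳ c)
coeff-scale-⊗ c (a ∷ p) Y zero
  rewrite coeff-∷-⊗ (c ℤ.* a) (map (c ℤ.*_) p) Y zero | coeff-∷-⊗ a p Y zero =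
  solve 3 (λ c a y → c :* a :* y :+ con (+ 0) := c :* (a :* y :+ con (+ 0))) refl c a (coeff Y zero)
coeff-scale-⊗ c (a ∷ p) Y (suc j)
  rewrite coeff-∷-⊗ (c ℤ.* a) (map (c ℤ.*_) p) Y (suc j) | coeff-∷-⊗ a p Y (suc j) | coeff-scale-⊗ c p Y j =
  solve 4 (λ c a y u → c :* a :* y :+ c :* u := c :* (a :* y :+ u)) refl c a (coeff Y (suc j)) (coeff (p ⊗ Y) j)

coeff-neg-⊗ : ∀ p Y → coeff (map -_ p ⊗ Y) ≗ λ j → - coeff (p ⊗ Y) j
coeff-neg-⊗ p Y j = begin
  coeff (map -_ p ⊗ Y) j          ≡⟨ cong (λ r → coeff (r ⊗ Y) j) (map-cong (sym ∘ ℤP.-1*i≡-i) p) ⟩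
  coeff (map (-1ℤ ℤ.*_) p ⊗ Y) j  ≡⟨ coeff-scale-⊗ -1ℤ p Y j ⟩
  -1ℤ ℤ.* coeff (p ⊗ Y) j         ≡⟨ ℤP.-1*i≡-i _ ⟩
  - coeff (p ⊗ Y) j               ∎
  where open ≡-Reasoning

coeff-constP-⊗ : ∀ c Y → coeff (constP c ⊗ Y) ≗ λ j → c ℤ.* coeff Y j
coeff-constP-⊗ c Y zero    = trans (coeff-∷-⊗ c [] Y zero) (ℤP.+-identityʳ _)
coeff-constP-⊗ c Y (suc j) = trans (coeff-∷-⊗ c [] Y (suc j)) (ℤP.+-identityʳ _)

coeff-scaled-⊗ : ∀ c X Y → coeff ((constP c ⊗ X) ⊗ Y) ≗ λ j → c ℤ.* coeff (X ⊗ Y) j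
coeff-scaled-⊗ c X Y j = begin
  coeff ((map (c ℤ.*_) X ⊕ constP (+ 0)) ⊗ Y) j
    ≡⟨ coeff-⊕-⊗ (map (c ℤ.*_) X) _ Y j ⟩
  coeff (map (c ℤ.*_) X ⊗ Y) j ℤ.+ coeff (constP (+ 0) ⊗ Y) j
    ≡⟨ cong₂ ℤ._+_ (coeff-scale-⊗ c X Y j) (coeff-constP-⊗ (+ 0) Y j) ⟩
  c ℤ.* coeff (X ⊗ Y) j ℤ.+ + 0
    ≡⟨ ℤP.+-identityʳ _ ⟩
  c ℤ.* coeff (X ⊗ Y) j ∎
  where open ≡-Reasoning

coeff-qPow-⊗ : ∀ a Y → coeff (qPow a ⊗ Y) ≗ shift a (coeff Y)
coeff-qPow-⊗ zero    Y j       = trans (coeff-constP-⊗ (+ 1) Y j) (ℤP.*-identityˡ _)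
coeff-qPow-⊗ (suc a) Y zero    = coeff-∷-⊗ (+ 0) (qPow a) Y zero
coeff-qPow-⊗ (suc a) Y (suc j) =
  trans (coeff-∷-⊗ (+ 0) (qPow a) Y (suc j)) (trans (ℤP.+-identityˡ _) (coeff-qPow-⊗ a Y j))

coeff-oneMinusQPow-⊗ : ∀ a Y → coeff (oneMinusQPow a ⊗ Y) ≗ λ j → coeff Y j - shift a (coeff Y) j
coeff-oneMinusQPow-⊗ a Y j = begin
  coeff ((constP (+ 1) ⊕ map -_ (qPow a)) ⊗ Y) j
    ≡⟨ coeff-⊕-⊗ (constP (+ 1)) (map -_ (qPow a)) Y j ⟩
  coeff (constP (+ 1) ⊗ Y) j ℤ.+ coeff (map -_ (qPow a) ⊗ Y) j
    ≡⟨ cong₂ ℤ._+_ (coeff-qPow-⊗ 0 Y j) (coeff-neg-⊗ (qPow a) Y j) ⟩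
  coeff Y j - coeff (qPow a ⊗ Y) j
    ≡⟨ cong (λ x → coeff Y j - x) (coeff-qPow-⊗ a Y j) ⟩
  coeff Y j - shift a (coeff Y) j ∎
  where open ≡-Reasoning

-- The expected value as a linear functional

sumOver : {A : Set} → List A → (A → ℤ) → ℤ
sumOver []       h = + 0
sumOver (x ∷ xs) h = h x ℤ.+ sumOver xs h

module _ {A : Set} where

  sumOver-++ : ∀ (xs ys : List A) h → sumOver (xs ++ ys) h ≡ sumOver xs h ℤ.+ sumOver ys h
  sumOver-++ []       ys h = sym (ℤP.+-identityˡ _)
  sumOver-++ (x ∷ xs) ys h = trans (cong (λ s → h x ℤ.+ s) (sumOver-++ xs ys h)) (sym (ℤP.+-assoc (h x) _ _))

  sumOver-map : ∀ {B : Set} (g : B → A) xs h → sumOver (map g xs) h ≡ sumOver xs (h ∘ g)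
  sumOver-map g []       h = refl
  sumOver-map g (x ∷ xs) h = cong (λ s → h (g x) ℤ.+ s) (sumOver-map g xs h)

  sumOver-cong : ∀ (xs : List A) {h g} → h ≗ g → sumOver xs h ≡ sumOver xs g
  sumOver-cong []       h≗g = refl
  sumOver-cong (x ∷ xs) h≗g = cong₂ ℤ._+_ (h≗g x) (sumOver-cong xs h≗g)

  sumOver-+ : ∀ (xs : List A) h g → sumOver xs (λ x → h x ℤ.+ g x) ≡ sumOver xs h ℤ.+ sumOver xs g
  sumOver-+ []       h g = refl
  sumOver-+ (x ∷ xs) h g rewrite sumOver-+ xs h g =
    solve 4 (λ a b c d → (a :+ b) :+ (c :+ d) := (a :+ c) :+ (b :+ d)) refl (h x) (g x) (sumOver xs h) (sumOver xs g)

  sumOver-neg : ∀ (xs : List A) h → sumOver xs (λ x → - h x) ≡ - sumOver xs h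
  sumOver-neg []       h = refl
  sumOver-neg (x ∷ xs) h rewrite sumOver-neg xs h = sym (ℤP.neg-distrib-+ (h x) _)

  sumOver-replicate : ∀ k (x : A) h → sumOver (replicate k x) h ≡ + k ℤ.* h x
  sumOver-replicate zero    x h = refl
  sumOver-replicate (suc k) x h = trans (cong (λ z → h x ℤ.+ z) (sumOver-replicate k x h))
    (solve 2 (λ a y → y :+ a :* y := (con (+ 1) :+ a) :* y) refl (+ k) (h x))

  sumOver-0 : ∀ (xs : List A) → sumOver xs (λ _ → + 0) ≡ + 0
  sumOver-0 []       = refl
  sumOver-0 (x ∷ xs) = trans (ℤP.+-identityˡ _) (sumOver-0 xs)

  sumOver-shift : ∀ (xs : List A) (c : A → ℤ) a (F : A → ℕ → ℤ) →
                  (λ j → sumOver xs (λ x → c x ℤ.* shift a (F x) j)) ≗ shift a (λ i → sumOver xs (λ x → c x ℤ.* F x i))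
  sumOver-shift xs c zero    F j       = refl
  sumOver-shift xs c (suc a) F zero    = trans (sumOver-cong xs (ℤP.*-zeroʳ ∘ c)) (sumOver-0 xs)
  sumOver-shift xs c (suc a) F (suc j) = sumOver-shift xs c a F j

Congruent : (VSet n → ℤ) → Set
Congruent φ = ∀ {A B} → A ≗ B → φ A ≡ φ B

-- coefficients of q^{f(S∖T)} ∏_{s∈T} (1 - q^{f(s)}), the probability that exactly T keeps a working sensor
weight : (S : VSet n) (f : Fin n → ℕ) → VSet n → ℕ → ℤ
weight S f T = coeff (qPow (fsum f (λ v → S v ∧ not (T v))) ⊗ prodOneMinus f T)

-- coefficients of the expected value of φ at the set of vertices keeping a working sensor
𝔼 : (S : VSet n) (f : Fin n → ℕ) → (VSet n → ℤ) → ℕ → ℤ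
𝔼 S f φ j = sumOver (subsetsOf S) λ T → φ T ℤ.* weight S f T j

𝔼-cong : (S : VSet n) (f : Fin n → ℕ) {φ ψ : VSet n → ℤ} → φ ≗ ψ → 𝔼 S f φ ≗ 𝔼 S f ψ
𝔼-cong S f φ≗ψ j = sumOver-cong (subsetsOf S) λ T → cong (ℤ._* weight S f T j) (φ≗ψ T)

𝔼-+ : (S : VSet n) (f : Fin n → ℕ) (φ ψ : VSet n → ℤ) →
      𝔼 S f (λ T → φ T ℤ.+ ψ T) ≗ λ j → 𝔼 S f φ j ℤ.+ 𝔼 S f ψ j
𝔼-+ S f φ ψ j = trans (sumOver-cong (subsetsOf S) λ T → ℤP.*-distribʳ-+ (weight S f T j) (φ T) (ψ T))
                      (sumOver-+ (subsetsOf S) _ _)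

𝔼-neg : (S : VSet n) (f : Fin n → ℕ) (φ : VSet n → ℤ) → 𝔼 S f (λ T → - φ T) ≗ λ j → - 𝔼 S f φ j
𝔼-neg S f φ j = trans (sumOver-cong (subsetsOf S) λ T → sym (ℤP.neg-distribˡ-* (φ T) (weight S f T j)))
                      (sumOver-neg (subsetsOf S) _)

𝔼-0 : (S : VSet n) (f : Fin n → ℕ) → 𝔼 S f (λ _ → + 0) ≗ λ _ → + 0
𝔼-0 S f j = sumOver-0 (subsetsOf S)

𝔼-sum : (S : VSet n) (f : Fin n → ℕ) {A : Set} (h : VSet n → A → ℕ) (xs : List A) →
        𝔼 S f (λ W → + sum (map (h W) xs)) ≗ λ j → sumOver xs λ x → 𝔼 S f (λ W → + h W x) j
𝔼-sum S f h []       j = 𝔼-0 S f j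
𝔼-sum S f h (x ∷ xs) j =
  trans (𝔼-cong S f (λ W → ℤP.pos-+ (h W x) (sum (map (h W) xs))) j)
        (trans (𝔼-+ S f (λ W → + h W x) (λ W → + sum (map (h W) xs)) j)
               (cong (λ z → 𝔼 S f (λ W → + h W x) j ℤ.+ z) (𝔼-sum S f h xs j)))

coeff-expectedObs : ∀ {N} (H : Graph N) (S : VSet N) (f : Fin N → ℕ) →
                    coeff (expectedObs H S f) ≗ 𝔼 S f (λ T → + card (Obs H T))
coeff-expectedObs {N} H S f j = go (subsetsOf S)
  where
  term : VSet N → Poly
  term T = (constP (+ card (Obs H T)) ⊗ qPow (fsum f (λ v → S v ∧ not (T v)))) ⊗ prodOneMinus f T
  go : ∀ Ts → coeff (foldr (λ T acc → term T ⊕ acc) [] Ts) j ≡ sumOver Ts λ T → + card (Obs H T) ℤ.* weight S f T j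
  go []       = refl
  go (T ∷ Ts) = trans (coeff-⊕ (term T) _ j)
    (cong₂ ℤ._+_ (coeff-scaled-⊗ (+ card (Obs H T)) (qPow (fsum f (λ v → S v ∧ not (T v)))) (prodOneMinus f T) j)
                 (go Ts))

cons : Bool → VSet n → VSet (suc n)
cons b T zero    = b
cons b T (suc i) = T i

-- the first vertex multiplies the weight by (1 - q^a) if one of its sensors survives, by q^a if all fail
firstFactor : (sensor survives : Bool) → ℕ → (ℕ → ℤ) → ℕ → ℤ
firstFactor s     true  a F j = F j - shift a F j
firstFactor true  false a F j = shift a F j
firstFactor false false a F j = F j

coeff-firstFactor : ∀ a s b e P →
  coeff (qPow ((if s ∧ not b then a else 0) + e) ⊗ ((if b then oneMinusQPow a else constP (+ 1)) ⊗ P))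
  ≗ firstFactor s b a (coeff (qPow e ⊗ P))
coeff-firstFactor a true false e P j = begin
  coeff (qPow (a + e) ⊗ (constP (+ 1) ⊗ P)) j  ≡⟨ coeff-qPow-⊗ (a + e) _ j ⟩
  shift (a + e) (coeff (constP (+ 1) ⊗ P)) j   ≡⟨ shift-cong (a + e) (coeff-qPow-⊗ 0 P) j ⟩
  shift (a + e) (coeff P) j                    ≡⟨ shift-+ a e (coeff P) j ⟩
  shift a (shift e (coeff P)) j                ≡⟨ shift-cong a (sym ∘ coeff-qPow-⊗ e P) j ⟩
  shift a (coeff (qPow e ⊗ P)) j               ∎
  where open ≡-Reasoning
coeff-firstFactor a false false e P j = begin
  coeff (qPow e ⊗ (constP (+ 1) ⊗ P)) j  ≡⟨ coeff-qPow-⊗ e _ j ⟩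
  shift e (coeff (constP (+ 1) ⊗ P)) j   ≡⟨ shift-cong e (coeff-qPow-⊗ 0 P) j ⟩
  shift e (coeff P) j                    ≡⟨ coeff-qPow-⊗ e P j ⟨
  coeff (qPow e ⊗ P) j                   ∎
  where open ≡-Reasoning
coeff-firstFactor a s true e P j rewrite ∧-zeroʳ s = begin
  coeff (qPow e ⊗ (oneMinusQPow a ⊗ P)) j
    ≡⟨ coeff-qPow-⊗ e _ j ⟩
  shift e (coeff (oneMinusQPow a ⊗ P)) j
    ≡⟨ shift-cong e (coeff-oneMinusQPow-⊗ a P) j ⟩
  shift e (λ i → coeff P i - shift a (coeff P) i) j
    ≡⟨ shift-− e (coeff P) _ j ⟩
  shift e (coeff P) j - shift e (shift a (coeff P)) j
    ≡⟨ cong₂ _-_ (coeff-qPow-⊗ e P j) (shift-comm a e (coeff P) j) ⟨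
  coeff (qPow e ⊗ P) j - shift a (shift e (coeff P)) j
    ≡⟨ cong (λ x → coeff (qPow e ⊗ P) j - x) (shift-cong a (sym ∘ coeff-qPow-⊗ e P) j) ⟩
  coeff (qPow e ⊗ P) j - shift a (coeff (qPow e ⊗ P)) j ∎
  where open ≡-Reasoning

weight-suc : (S : VSet (suc n)) (f : Fin (suc n) → ℕ) (T : VSet (suc n)) →
             weight S f T ≗ firstFactor (S zero) (T zero) (f zero) (weight (S ∘ suc) (f ∘ suc) (T ∘ suc))
weight-suc S f T = coeff-firstFactor (f zero) (S zero) (T zero) _ (prodOneMinus (f ∘ suc) (T ∘ suc))

prodOneMinus-cong : (f : Fin n → ℕ) {A B : VSet n} → A ≗ B → prodOneMinus f A ≡ prodOneMinus f B
prodOneMinus-cong {zero}  f A≗B = refl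
prodOneMinus-cong {suc n} f A≗B =
  cong₂ _⊗_ (cong (λ b → if b then oneMinusQPow (f zero) else constP (+ 1)) (A≗B zero))
            (prodOneMinus-cong (f ∘ suc) (A≗B ∘ suc))

weight-cong : (S : VSet n) (f : Fin n → ℕ) {A B : VSet n} → A ≗ B → weight S f A ≗ weight S f B
weight-cong S f A≗B j =
  cong₂ (λ k P → coeff (qPow k ⊗ P) j) (fsum-cong f λ v → cong (λ b → S v ∧ not b) (A≗B v)) (prodOneMinus-cong f A≗B)

branch : Bool → ℕ → (F₀ F₁ : ℕ → ℤ) → ℕ → ℤ
branch true  a F₀ F₁ j = shift a F₀ j ℤ.+ (F₁ j - shift a F₁ j)
branch false a F₀ F₁ j = F₀ j

branch-cong : ∀ s a {F₀ F₁ G₀ G₁} → F₀ ≗ G₀ → F₁ ≗ G₁ → branch s a F₀ F₁ ≗ branch s a G₀ G₁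
branch-cong true  a F₀≗G₀ F₁≗G₁ j =
  cong₂ ℤ._+_ (shift-cong a F₀≗G₀ j) (cong₂ _-_ (F₁≗G₁ j) (shift-cong a F₁≗G₁ j))
branch-cong false a F₀≗G₀ F₁≗G₁ j = F₀≗G₀ j

branch-sumOver : ∀ s a (L : List (VSet n)) (φ₀ φ₁ : VSet n → ℤ) (w : VSet n → ℕ → ℤ) j →
  sumOver L (λ T → φ₀ T ℤ.* firstFactor s false a (w T) j)
    ℤ.+ (if s then sumOver L (λ T → φ₁ T ℤ.* firstFactor s true a (w T) j) else + 0)
  ≡ branch s a (λ i → sumOver L λ T → φ₀ T ℤ.* w T i) (λ i → sumOver L λ T → φ₁ T ℤ.* w T i) j
branch-sumOver false a L φ₀ φ₁ w j = ℤP.+-identityʳ _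
branch-sumOver true  a L φ₀ φ₁ w j = cong₂ ℤ._+_ (sumOver-shift L φ₀ a w j) (begin
  sumOver L (λ T → φ₁ T ℤ.* (w T j - shift a (w T) j))
    ≡⟨ sumOver-cong L (λ T → solve 3 (λ x y z → x :* (y :- z) := x :* y :+ (:- (x :* z))) refl
                                     (φ₁ T) (w T j) (shift a (w T) j)) ⟩
  sumOver L (λ T → φ₁ T ℤ.* w T j ℤ.+ - (φ₁ T ℤ.* shift a (w T) j))
    ≡⟨ sumOver-+ L _ _ ⟩
  sumOver L (λ T → φ₁ T ℤ.* w T j) ℤ.+ sumOver L (λ T → - (φ₁ T ℤ.* shift a (w T) j))
    ≡⟨ cong (λ x → sumOver L (λ T → φ₁ T ℤ.* w T j) ℤ.+ x)
            (trans (sumOver-neg L _) (cong -_ (sumOver-shift L φ₁ a w j))) ⟩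
  sumOver L (λ T → φ₁ T ℤ.* w T j) - shift a (λ i → sumOver L λ T → φ₁ T ℤ.* w T i) j ∎)
  where open ≡-Reasoning

sumOver-if : ∀ {A : Set} s (xs : List A) h → sumOver (if s then xs else []) h ≡ (if s then sumOver xs h else + 0)
sumOver-if true  xs h = refl
sumOver-if false xs h = refl

Congruent-cons : {φ : VSet (suc n) → ℤ} → Congruent φ → ∀ b → Congruent (φ ∘ cons b)
Congruent-cons φ-cong b A≗B = φ-cong λ { zero → refl ; (suc i) → A≗B i }

𝔼-suc : (S : VSet (suc n)) (f : Fin (suc n) → ℕ) (φ : VSet (suc n) → ℤ) → Congruent φ →
        𝔼 S f φ ≗ branch (S zero) (f zero) (𝔼 (S ∘ suc) (f ∘ suc) (φ ∘ cons false))
                                            (𝔼 (S ∘ suc) (f ∘ suc) (φ ∘ cons true))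
𝔼-suc {n} S f φ φ-cong j =
  trans (sumOver-++ (map _ L) _ summand)
    (trans (cong₂ ℤ._+_ (viaCons false _ λ T → λ { zero → refl ; (suc i) → refl })
                        (trans (sumOver-if (S zero) (map _ L) summand)
                               (cong (λ x → if S zero then x else + 0)
                                     (viaCons true _ λ T → λ { zero → refl ; (suc i) → refl }))))
           (branch-sumOver (S zero) (f zero) L (φ ∘ cons false) (φ ∘ cons true) (weight (S ∘ suc) (f ∘ suc)) j))
  where
  L : List (VSet n)
  L = subsetsOf (S ∘ suc)
  summand : VSet (suc n) → ℤ
  summand T = φ T ℤ.* weight S f T j
  -- subsetsOf extends subsets by a function local to Defs, which only agrees pointwise with cons
  viaCons : ∀ b (g : VSet n → VSet (suc n)) → (∀ T → g T ≗ cons b T) →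
            sumOver (map g L) summand
            ≡ sumOver L λ T → φ (cons b T) ℤ.* firstFactor (S zero) b (f zero) (weight (S ∘ suc) (f ∘ suc) T) j
  viaCons b g g≗cons = trans (sumOver-map g L summand) (sumOver-cong L λ T →
    cong₂ ℤ._*_ (φ-cong (g≗cons T)) (trans (weight-cong S f (g≗cons T) j) (weight-suc S f (cons b T) j)))

𝔼-empty : (S : VSet 0) (f : Fin 0 → ℕ) (φ : VSet 0 → ℤ) → Congruent φ →
          ∀ X → 𝔼 S f φ ≗ λ j → φ X ℤ.* δ 0 j
𝔼-empty S f φ φ-cong X zero    = trans (ℤP.+-identityʳ _) (cong (ℤ._* + 1) (φ-cong λ ()))
𝔼-empty S f φ φ-cong X (suc j) = trans (ℤP.+-identityʳ _) (cong (ℤ._* + 0) (φ-cong λ ()))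

𝔼-cong-sensors : {S S′ : VSet n} {f f′ : Fin n → ℕ} {φ φ′ : VSet n → ℤ} → Congruent φ → Congruent φ′ →
                 S ≗ S′ → f ≗ f′ → φ ≗ φ′ → 𝔼 S f φ ≗ 𝔼 S′ f′ φ′
𝔼-cong-sensors {zero} φ-cong φ′-cong S≗S′ f≗f′ φ≗φ′ j = cong (λ x → x ℤ.* _ ℤ.+ + 0) (φ≗φ′ _)
𝔼-cong-sensors {suc n} {S} {S′} {f} {f′} {φ} {φ′} φ-cong φ′-cong S≗S′ f≗f′ φ≗φ′ j = begin
  𝔼 S f φ j
    ≡⟨ 𝔼-suc S f φ φ-cong j ⟩
  branch (S zero) (f zero) (𝔼′ S f φ false) (𝔼′ S f φ true) j
    ≡⟨ cong₂ (λ s a → branch s a _ _ j) (S≗S′ zero) (f≗f′ zero) ⟩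
  branch (S′ zero) (f′ zero) (𝔼′ S f φ false) (𝔼′ S f φ true) j
    ≡⟨ branch-cong (S′ zero) (f′ zero) (IH false) (IH true) j ⟩
  branch (S′ zero) (f′ zero) (𝔼′ S′ f′ φ′ false) (𝔼′ S′ f′ φ′ true) j
    ≡⟨ 𝔼-suc S′ f′ φ′ φ′-cong j ⟨
  𝔼 S′ f′ φ′ j ∎
  where
  open ≡-Reasoning
  𝔼′ : VSet (suc n) → (Fin (suc n) → ℕ) → (VSet (suc n) → ℤ) → Bool → ℕ → ℤ
  𝔼′ S f φ b = 𝔼 (S ∘ suc) (f ∘ suc) (φ ∘ cons b)
  IH : ∀ b → 𝔼′ S f φ b ≗ 𝔼′ S′ f′ φ′ b
  IH b = 𝔼-cong-sensors (Congruent-cons φ-cong b) (Congruent-cons φ′-cong b)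
                        (S≗S′ ∘ suc) (f≗f′ ∘ suc) (φ≗φ′ ∘ cons b)

𝔼-no-sensors : (S : VSet n) (f : Fin n → ℕ) (φ : VSet n → ℤ) → Congruent φ → (∀ v → S v ≡ false) →
               𝔼 S f φ ≗ λ j → φ (λ _ → false) ℤ.* δ 0 j
𝔼-no-sensors {zero}  S f φ φ-cong none = 𝔼-empty S f φ φ-cong (λ _ → false)
𝔼-no-sensors {suc n} S f φ φ-cong none j =
  trans (𝔼-suc S f φ φ-cong j) (firstHasNone (S zero) (none zero))
  where
  firstHasNone : ∀ s → s ≡ false →
    branch s (f zero) (𝔼 (S ∘ suc) (f ∘ suc) (φ ∘ cons false)) (𝔼 (S ∘ suc) (f ∘ suc) (φ ∘ cons true)) j
    ≡ φ (λ _ → false) ℤ.* δ 0 j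
  firstHasNone .false refl =
    trans (𝔼-no-sensors (S ∘ suc) (f ∘ suc) (φ ∘ cons false) (Congruent-cons φ-cong false) (none ∘ suc) j)
          (cong (ℤ._* δ 0 j) (φ-cong λ { zero → refl ; (suc i) → refl }))

[,]-splitAt-suc : ∀ {A : Set} n m (X : Fin (suc n) → A) (d : A) i →
                  [ X , const d ]′ (splitAt (suc n) {m} (suc i)) ≡ [ X ∘ suc , const d ]′ (splitAt n i)
[,]-splitAt-suc n m X d i with splitAt n {m} i
... | inj₁ _ = refl
... | inj₂ _ = refl

Congruent-liftSet : ∀ m {φ : VSet (n + m) → ℤ} → Congruent φ → Congruent (φ ∘ liftSet m)
Congruent-liftSet {n} m φ-cong {A} {B} A≗B = φ-cong lifted
  where
  lifted : liftSet m A ≗ liftSet m B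
  lifted x with splitAt n x
  ... | inj₁ v = A≗B v
  ... | inj₂ _ = refl

𝔼-liftSet : ∀ n m (S : VSet n) (f : Fin n → ℕ) (φ : VSet (n + m) → ℤ) → Congruent φ →
            𝔼 (liftSet m S) (liftMult m f) φ ≗ 𝔼 S f (φ ∘ liftSet m)
𝔼-liftSet zero m S f φ φ-cong j =
  trans (𝔼-no-sensors (liftSet m S) (liftMult m f) φ φ-cong (λ _ → refl) j)
        (sym (𝔼-empty S f (φ ∘ liftSet m) (Congruent-liftSet m φ-cong) (λ ()) j))
𝔼-liftSet (suc n) m S f φ φ-cong j =
  trans (𝔼-suc (liftSet m S) (liftMult m f) φ φ-cong j)
        (trans (branch-cong (S zero) (f zero) (viaIH false) (viaIH true) j)
               (sym (𝔼-suc S f (φ ∘ liftSet m) (Congruent-liftSet m φ-cong) j)))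
  where
  viaIH : ∀ b → 𝔼 (liftSet m S ∘ suc) (liftMult m f ∘ suc) (φ ∘ cons b)
                ≗ 𝔼 (S ∘ suc) (f ∘ suc) (φ ∘ liftSet m ∘ cons b)
  viaIH b i = begin
    𝔼 (liftSet m S ∘ suc) (liftMult m f ∘ suc) (φ ∘ cons b) i
      ≡⟨ 𝔼-cong-sensors φb-cong φb-cong ([,]-splitAt-suc n m S false) ([,]-splitAt-suc n m f 0) (λ _ → refl) i ⟩
    𝔼 (liftSet m (S ∘ suc)) (liftMult m (f ∘ suc)) (φ ∘ cons b) i
      ≡⟨ 𝔼-liftSet n m (S ∘ suc) (f ∘ suc) (φ ∘ cons b) φb-cong i ⟩
    𝔼 (S ∘ suc) (f ∘ suc) (φ ∘ cons b ∘ liftSet m) i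
      ≡⟨ 𝔼-cong-sensors (Congruent-liftSet m φb-cong) (Congruent-cons (Congruent-liftSet m φ-cong) b)
           (λ _ → refl) (λ _ → refl)
           (λ T → φ-cong λ { zero → refl ; (suc x) → sym ([,]-splitAt-suc n m (cons b T) false x) }) i ⟩
    𝔼 (S ∘ suc) (f ∘ suc) (φ ∘ liftSet m ∘ cons b) i ∎
    where
    open ≡-Reasoning
    φb-cong : Congruent (φ ∘ cons b)
    φb-cong = Congruent-cons φ-cong b

𝟙 : Bool → ℤ
𝟙 b = if b then + 1 else + 0

𝟙ℕ : Bool → ℕ
𝟙ℕ b = if b then 1 else 0

+𝟙ℕ : ∀ b → + 𝟙ℕ b ≡ 𝟙 b
+𝟙ℕ true  = refl
+𝟙ℕ false = refl

𝟙-∧ : ∀ a b → 𝟙 (a ∧ b) ≡ 𝟙 a ℤ.+ 𝟙 b - 𝟙 (a ∨ b)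
𝟙-∧ true  true  = refl
𝟙-∧ true  false = refl
𝟙-∧ false true  = refl
𝟙-∧ false false = refl

meets : VSet n → VSet n → Bool
meets X T = anyF λ v → X v ∧ T v

branch-same : ∀ s a F → branch s a F F ≗ F
branch-same true  a F j = solve 2 (λ x y → x :+ (y :- x) := y) refl (shift a F j) (F j)
branch-same false a F j = refl

𝔼-disjoint : (S X : VSet n) (f : Fin n → ℕ) → X ⊆ᵥ S → 𝔼 S f (λ T → 𝟙 (not (meets X T))) ≗ δ (fsum f X)
𝔼-disjoint {zero}  S X f X⊆S j =
  trans (𝔼-empty S f (λ T → 𝟙 (not (meets X T))) (λ _ → refl) (λ ()) j) (ℤP.*-identityˡ _)
𝔼-disjoint {suc n} S X f X⊆S j =
  trans (𝔼-suc S f φ φ-cong j) (byFirst (X zero) (S zero) refl refl)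
  where
  φ : VSet (suc n) → ℤ
  φ T = 𝟙 (not (meets X T))
  φ-cong : Congruent φ
  φ-cong A≗B = cong (𝟙 ∘ not) (anyF-cong λ v → cong (X v ∧_) (A≗B v))
  IH : 𝔼 (S ∘ suc) (f ∘ suc) (λ T → 𝟙 (not (meets (X ∘ suc) T))) ≗ δ (fsum (f ∘ suc) (X ∘ suc))
  IH = 𝔼-disjoint (S ∘ suc) (X ∘ suc) (f ∘ suc) (X⊆S ∘ suc)
  absentFirst : ∀ b → X zero ∧ b ≡ false → 𝔼 (S ∘ suc) (f ∘ suc) (φ ∘ cons b) ≗ δ (fsum (f ∘ suc) (X ∘ suc))
  absentFirst b X0b i =
    trans (𝔼-cong (S ∘ suc) (f ∘ suc) (λ T → cong (λ c → 𝟙 (not (c ∨ meets (X ∘ suc) T))) X0b) i) (IH i)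
  fsum-byFirst : ∀ {x} → X zero ≡ x → δ ((if x then f zero else 0) + fsum (f ∘ suc) (X ∘ suc)) j ≡ δ (fsum f X) j
  fsum-byFirst X0 = cong (λ x → δ ((if x then f zero else 0) + fsum (f ∘ suc) (X ∘ suc)) j) (sym X0)
  byFirst : ∀ x s → X zero ≡ x → S zero ≡ s →
    branch s (f zero) (𝔼 (S ∘ suc) (f ∘ suc) (φ ∘ cons false)) (𝔼 (S ∘ suc) (f ∘ suc) (φ ∘ cons true)) j
    ≡ δ (fsum f X) j
  byFirst false s X0 S0 =
    trans (branch-cong s (f zero) (absentFirst false (∧-zeroʳ _)) (absentFirst true (cong (_∧ true) X0)) j)
          (trans (branch-same s (f zero) _ j) (fsum-byFirst X0))
  byFirst true false X0 S0 = contradiction (trans (sym (X⊆S zero X0)) S0) λ ()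
  -- a working sensor on the first vertex meets X, so only the branch where it fails contributes
  byFirst true true X0 S0 = begin
    shift (f zero) F₀ j ℤ.+ (F₁ j - shift (f zero) F₁ j)
      ≡⟨ cong₂ ℤ._+_ (shift-cong (f zero) (absentFirst false (∧-zeroʳ _)) j)
                     (cong₂ _-_ (F₁≗0 j) (trans (shift-cong (f zero) F₁≗0 j) (shift-0 (f zero) j))) ⟩
    shift (f zero) (δ (fsum (f ∘ suc) (X ∘ suc))) j ℤ.+ (+ 0 - + 0)
      ≡⟨ ℤP.+-identityʳ _ ⟩
    shift (f zero) (δ (fsum (f ∘ suc) (X ∘ suc))) j
      ≡⟨ shift-δ (f zero) _ j ⟩
    δ (f zero + fsum (f ∘ suc) (X ∘ suc)) j
      ≡⟨ fsum-byFirst X0 ⟩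
    δ (fsum f X) j ∎
    where
    open ≡-Reasoning
    F₀ F₁ : ℕ → ℤ
    F₀ = 𝔼 (S ∘ suc) (f ∘ suc) (φ ∘ cons false)
    F₁ = 𝔼 (S ∘ suc) (f ∘ suc) (φ ∘ cons true)
    F₁≗0 : F₁ ≗ λ _ → + 0
    F₁≗0 i = trans (𝔼-cong (S ∘ suc) (f ∘ suc) (λ T → cong (λ c → 𝟙 (not (c ∧ true ∨ meets (X ∘ suc) T))) X0) i)
                   (𝔼-0 (S ∘ suc) (f ∘ suc) i)

meets-∅ : (T : VSet n) → meets (λ _ → false) T ≡ false
meets-∅ T = anyF-false (λ v → false ∧ T v) λ _ → refl

𝔼-one : (S : VSet n) (f : Fin n → ℕ) → 𝔼 S f (λ _ → + 1) ≗ δ 0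
𝔼-one {n} S f j = begin
  𝔼 S f (λ _ → + 1) j
    ≡⟨ 𝔼-cong S f (λ T → cong (𝟙 ∘ not) (sym (meets-∅ {n} T))) j ⟩
  𝔼 S f (λ T → 𝟙 (not (meets (λ _ → false) T))) j
    ≡⟨ 𝔼-disjoint S (λ _ → false) f (λ _ ()) j ⟩
  δ (fsum f (λ _ → false)) j
    ≡⟨ cong (λ k → δ k j) (fsum-∅ f) ⟩
  δ 0 j ∎
  where open ≡-Reasoning

𝔼-meets : (S X : VSet n) (f : Fin n → ℕ) → X ⊆ᵥ S →
          𝔼 S f (λ T → 𝟙 (meets X T)) ≗ λ j → δ 0 j - δ (fsum f X) j
𝔼-meets S X f X⊆S j = begin
  𝔼 S f (λ T → 𝟙 (meets X T)) j
    ≡⟨ 𝔼-cong S f (λ T → complement (meets X T)) j ⟩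
  𝔼 S f (λ T → + 1 ℤ.+ - 𝟙 (not (meets X T))) j
    ≡⟨ 𝔼-+ S f (λ _ → + 1) (λ T → - 𝟙 (not (meets X T))) j ⟩
  𝔼 S f (λ _ → + 1) j ℤ.+ 𝔼 S f (λ T → - 𝟙 (not (meets X T))) j
    ≡⟨ cong₂ ℤ._+_ (𝔼-one S f j) (𝔼-neg S f (λ T → 𝟙 (not (meets X T))) j) ⟩
  δ 0 j - 𝔼 S f (λ T → 𝟙 (not (meets X T))) j
    ≡⟨ cong (λ x → δ 0 j - x) (𝔼-disjoint S X f X⊆S j) ⟩
  δ 0 j - δ (fsum f X) j ∎
  where
  open ≡-Reasoning
  complement : ∀ b → 𝟙 b ≡ + 1 ℤ.+ - 𝟙 (not b)
  complement true  = refl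
  complement false = refl

｛_｝ : Fin n → VSet n
｛ a ｝ v = v == a

meets-｛｝ : (a : Fin n) (T : VSet n) → meets ｛ a ｝ T ≡ T a
meets-｛｝ a T = ⇔⇒≡ to (λ Ta → anyF-intro (λ v → ｛ a ｝ v ∧ T v) a (∧-intro (==-refl a) Ta))
  where
  to : meets ｛ a ｝ T ≡ true → T a ≡ true
  to h with anyF-elim (λ v → ｛ a ｝ v ∧ T v) h
  ... | v , v∈ with ∧-elim (v == a) v∈
  ...   | v=a , Tv rewrite ==-sound v=a = Tv

fsum-｛｝ : (f : Fin n → ℕ) (a : Fin n) → fsum f ｛ a ｝ ≡ f a
fsum-｛｝ f a = fsum-singleton f ｛ a ｝ a (==-refl a) λ _ → ==-sound

𝔼-member : (S : VSet n) (f : Fin n → ℕ) {a : Fin n} → S a ≡ true →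
           𝔼 S f (λ T → 𝟙 (T a)) ≗ λ j → δ 0 j - δ (f a) j
𝔼-member S f {a} Sa j = begin
  𝔼 S f (λ T → 𝟙 (T a)) j
    ≡⟨ 𝔼-cong S f (λ T → cong 𝟙 (sym (meets-｛｝ a T))) j ⟩
  𝔼 S f (λ T → 𝟙 (meets ｛ a ｝ T)) j
    ≡⟨ 𝔼-meets S ｛ a ｝ f (λ v v=a → subst (λ x → S x ≡ true) (sym (==-sound v=a)) Sa) j ⟩
  δ 0 j - δ (fsum f ｛ a ｝) j
    ≡⟨ cong (λ k → δ 0 j - δ k j) (fsum-｛｝ f a) ⟩
  δ 0 j - δ (f a) j ∎
  where open ≡-Reasoning

𝔼-card : (S : VSet n) (f : Fin n → ℕ) {k : ℕ} (Q : Fin k → VSet n → Bool) (j : ℕ) →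
         (∀ a → 𝔼 S f (λ T → 𝟙 (Q a T)) j ≡ + 0) → 𝔼 S f (λ T → + card (λ a → Q a T)) j ≡ + 0
𝔼-card S f {zero}  Q j vanish = 𝔼-0 S f j
𝔼-card S f {suc k} Q j vanish = begin
  𝔼 S f (λ T → + card (λ a → Q a T)) j
    ≡⟨ 𝔼-cong S f (λ T → trans (ℤP.pos-+ (𝟙ℕ (Q zero T)) (card (λ a → Q (suc a) T)))
                                   (cong (ℤ._+ + card (λ a → Q (suc a) T)) (+𝟙ℕ (Q zero T)))) j ⟩
  𝔼 S f (λ T → 𝟙 (Q zero T) ℤ.+ + card (λ a → Q (suc a) T)) j
    ≡⟨ 𝔼-+ S f (λ T → 𝟙 (Q zero T)) (λ T → + card (λ a → Q (suc a) T)) j ⟩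
  𝔼 S f (λ T → 𝟙 (Q zero T)) j ℤ.+ 𝔼 S f (λ T → + card (λ a → Q (suc a) T)) j
    ≡⟨ cong₂ ℤ._+_ (vanish zero) (𝔼-card S f (Q ∘ suc) j (vanish ∘ suc)) ⟩
  + 0 ∎
  where open ≡-Reasoning

-- The extended graph

-- A gadget has a tap adjacent to each listed vertex a of G (only the taps at those a have edges), a sink
-- adjacent to those taps and, when rooted, a hub adjacent to the root and to those taps; hub and sink
-- each carry two leaves.
record Gadget (S : VSet n) : Set where
  field
    taps   : VSet n
    taps⊆S : taps ⊆ᵥ S
    rooted : Bool
    root   : Fin n
    root∈S : S root ≡ true
open Gadget

fires : {S : VSet n} → VSet n → Gadget S → Bool
fires W g = meets (taps g) W ∧ (rooted g ⇒ᵇ W (root g))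

-- the observed vertices of a gadget when the working sensors sit at W; the sink needs one round (fl)
gadgetCount : {S : VSet n} → VSet n → Bool → Gadget S → ℕ
gadgetCount W fl g = card (λ a → taps g a ∧ W a) + (𝟙ℕ (rooted g ∧ W (root g)) + 𝟙ℕ (fl ∧ fires W g))

data GadgetVertex (n : ℕ) : Set where
  tap              : Fin n → GadgetVertex n
  hub sink         : GadgetVertex n
  hubLeaf sinkLeaf : Bool → GadgetVertex n

-- every sensor vertex v of G gets the two leaves pendant b v, so it forces only while a sensor on it works
data Vertex (n ℓ : ℕ) : Set where
  old      : Fin n → Vertex n ℓ
  pendant  : Bool → Fin n → Vertex n ℓ
  inGadget : Fin ℓ → GadgetVertex n → Vertex n ℓ

private
  special : Fin 6 → GadgetVertex n
  special zero                                = hub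
  special (suc zero)                          = hubLeaf false
  special (suc (suc zero))                    = hubLeaf true
  special (suc (suc (suc zero)))              = sink
  special (suc (suc (suc (suc zero))))        = sinkLeaf false
  special (suc (suc (suc (suc (suc zero)))))  = sinkLeaf true

  toSum : GadgetVertex n → Fin n ⊎ Fin 6
  toSum (tap a)          = inj₁ a
  toSum hub              = inj₂ zero
  toSum (hubLeaf false)  = inj₂ (suc zero)
  toSum (hubLeaf true)   = inj₂ (suc (suc zero))
  toSum sink             = inj₂ (suc (suc (suc zero)))
  toSum (sinkLeaf false) = inj₂ (suc (suc (suc (suc zero))))
  toSum (sinkLeaf true)  = inj₂ (suc (suc (suc (suc (suc zero)))))

  toSum-[,] : (s : Fin n ⊎ Fin 6) → toSum ([ tap , special ]′ s) ≡ s
  toSum-[,] (inj₁ a) = refl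
  toSum-[,] (inj₂ zero) = refl
  toSum-[,] (inj₂ (suc zero)) = refl
  toSum-[,] (inj₂ (suc (suc zero))) = refl
  toSum-[,] (inj₂ (suc (suc (suc zero)))) = refl
  toSum-[,] (inj₂ (suc (suc (suc (suc zero))))) = refl
  toSum-[,] (inj₂ (suc (suc (suc (suc (suc zero)))))) = refl

  [,]-toSum : (g : GadgetVertex n) → [ tap , special ]′ (toSum g) ≡ g
  [,]-toSum (tap a)          = refl
  [,]-toSum hub              = refl
  [,]-toSum (hubLeaf false)  = refl
  [,]-toSum (hubLeaf true)   = refl
  [,]-toSum sink             = refl
  [,]-toSum (sinkLeaf false) = refl
  [,]-toSum (sinkLeaf true)  = refl

decodeGadgetVertex : Fin (n + 6) → GadgetVertex n
decodeGadgetVertex {n} = [ tap , special ]′ ∘ splitAt n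

encodeGadgetVertex : GadgetVertex n → Fin (n + 6)
encodeGadgetVertex {n} = join n 6 ∘ toSum

decode-encodeGadgetVertex : (g : GadgetVertex n) → decodeGadgetVertex (encodeGadgetVertex g) ≡ g
decode-encodeGadgetVertex {n} g = trans (cong [ tap , special ]′ (FinP.splitAt-join n 6 (toSum g))) ([,]-toSum g)

encode-decodeGadgetVertex : (y : Fin (n + 6)) → encodeGadgetVertex (decodeGadgetVertex {n} y) ≡ y
encode-decodeGadgetVertex {n} y = trans (cong (join n 6) (toSum-[,] (splitAt n y))) (FinP.join-splitAt n 6 y)

extraVertices : ℕ → ℕ → ℕ
extraVertices n ℓ = n + (n + ℓ * (n + 6))

decodeGadgets : ∀ {ℓ} → Fin (ℓ * (n + 6)) → Vertex n ℓ
decodeGadgets {n} = uncurry (λ i z → inGadget i (decodeGadgetVertex z)) ∘ remQuot (n + 6)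

decode : ∀ {ℓ} → Fin (n + extraVertices n ℓ) → Vertex n ℓ
decode {n} = [ old , [ pendant false , [ pendant true , decodeGadgets ]′ ∘ splitAt n ]′ ∘ splitAt n ]′ ∘ splitAt n

encode : ∀ {ℓ} → Vertex n ℓ → Fin (n + extraVertices n ℓ)
encode {n} {ℓ} (old v)          = v ↑ˡ extraVertices n ℓ
encode {n} {ℓ} (pendant false v) = n ↑ʳ (v ↑ˡ (n + ℓ * (n + 6)))
encode {n} {ℓ} (pendant true v)  = n ↑ʳ (n ↑ʳ (v ↑ˡ ℓ * (n + 6)))
encode {n} {ℓ} (inGadget i g)   = n ↑ʳ (n ↑ʳ (n ↑ʳ combine i (encodeGadgetVertex g)))

decode-encode : ∀ {ℓ} (v : Vertex n ℓ) → decode (encode v) ≡ v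
decode-encode {n} {ℓ} (old v) rewrite FinP.splitAt-↑ˡ n v (extraVertices n ℓ) = refl
decode-encode {n} {ℓ} (pendant false v)
  rewrite FinP.splitAt-↑ʳ n (extraVertices n ℓ) (v ↑ˡ (n + ℓ * (n + 6)))
        | FinP.splitAt-↑ˡ n v (n + ℓ * (n + 6)) = refl
decode-encode {n} {ℓ} (pendant true v)
  rewrite FinP.splitAt-↑ʳ n (extraVertices n ℓ) (n ↑ʳ (v ↑ˡ ℓ * (n + 6)))
        | FinP.splitAt-↑ʳ n (n + ℓ * (n + 6)) (v ↑ˡ ℓ * (n + 6))
        | FinP.splitAt-↑ˡ n v (ℓ * (n + 6)) = refl
decode-encode {n} {ℓ} (inGadget i g)
  rewrite FinP.splitAt-↑ʳ n (extraVertices n ℓ) (n ↑ʳ (n ↑ʳ combine i (encodeGadgetVertex g)))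
        | FinP.splitAt-↑ʳ n (n + ℓ * (n + 6)) (n ↑ʳ combine i (encodeGadgetVertex g))
        | FinP.splitAt-↑ʳ n (ℓ * (n + 6)) (combine i (encodeGadgetVertex g)) =
  trans (cong (uncurry λ i z → inGadget i (decodeGadgetVertex z)) (FinP.remQuot-combine i (encodeGadgetVertex g)))
        (cong (inGadget i) (decode-encodeGadgetVertex g))

[,]-splitAt-section : ∀ {A B : Set} n {m} (e : A → B) (ι : Fin (n + m) → B) {d₁ : Fin n → A} {d₂ : Fin m → A} →
                      (∀ x → e (d₁ x) ≡ ι (x ↑ˡ m)) → (∀ y → e (d₂ y) ≡ ι (n ↑ʳ y)) →
                      ∀ z → e ([ d₁ , d₂ ]′ (splitAt n z)) ≡ ι z
[,]-splitAt-section n {m} e ι e∘d₁ e∘d₂ z with splitAt n z in eq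
... | inj₁ x = trans (e∘d₁ x) (cong ι (trans (cong (join n m) (sym eq)) (FinP.join-splitAt n m z)))
... | inj₂ y = trans (e∘d₂ y) (cong ι (trans (cong (join n m) (sym eq)) (FinP.join-splitAt n m z)))

encode-decode : ∀ {ℓ} (x : Fin (n + extraVertices n ℓ)) → encode {n} {ℓ} (decode x) ≡ x
encode-decode {n} {ℓ} =
  [,]-splitAt-section n encode (λ z → z) (λ _ → refl)
    ([,]-splitAt-section n encode (n ↑ʳ_) (λ _ → refl)
      ([,]-splitAt-section n encode (λ z → n ↑ʳ (n ↑ʳ z)) (λ _ → refl) gadgets))
  where
  gadgets : ∀ y → encode (decodeGadgets {n} {ℓ} y) ≡ n ↑ʳ (n ↑ʳ (n ↑ʳ y))
  gadgets y = cong (λ w → n ↑ʳ (n ↑ʳ (n ↑ʳ w)))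
    (trans (cong (combine (proj₁ (remQuot {ℓ} (n + 6) y))) (encode-decodeGadgetVertex (proj₂ (remQuot {ℓ} (n + 6) y))))
           (FinP.combine-remQuot {ℓ} (n + 6) y))

module Extension {n} (G : Graph n) (S : VSet n) (gs : List (Gadget S)) where

  ℓ : ℕ
  ℓ = length gs

  private
    M N : ℕ
    M = extraVertices n ℓ
    N = n + M

    isOld : Vertex n ℓ → Bool
    isOld (old _) = true
    isOld _       = false

  gadget : Fin ℓ → Gadget S
  gadget = lookup gs

  vertex : Fin N → Vertex n ℓ
  vertex = decode

  arc : Vertex n ℓ → Vertex n ℓ → Bool
  arc (old u)              (old v)                   = adj G u v
  arc (old u)              (pendant _ v)             = (u == v) ∧ S v
  arc (old u)              (inGadget i (tap a))      = (u == a) ∧ taps (gadget i) a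
  arc (old u)              (inGadget i hub)          = (u == root (gadget i)) ∧ rooted (gadget i)
  arc (inGadget i (tap a)) (inGadget j hub)          = (i == j) ∧ (taps (gadget i) a ∧ rooted (gadget i))
  arc (inGadget i (tap a)) (inGadget j sink)         = (i == j) ∧ taps (gadget i) a
  arc (inGadget i hub)     (inGadget j (hubLeaf _))  = i == j
  arc (inGadget i sink)    (inGadget j (sinkLeaf _)) = i == j
  arc _                    _                         = false

  data Arc : Vertex n ℓ → Vertex n ℓ → Set where
    old-old       : ∀ {u v} → adj G u v ≡ true → Arc (old u) (old v)
    old-pendant   : ∀ {v b} → S v ≡ true → Arc (old v) (pendant b v)
    old-tap       : ∀ {i a} → taps (gadget i) a ≡ true → Arc (old a) (inGadget i (tap a))
    old-hub       : ∀ {i} → rooted (gadget i) ≡ true → Arc (old (root (gadget i))) (inGadget i hub)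
    tap-hub       : ∀ {i a} → taps (gadget i) a ≡ true → rooted (gadget i) ≡ true →
                    Arc (inGadget i (tap a)) (inGadget i hub)
    tap-sink      : ∀ {i a} → taps (gadget i) a ≡ true → Arc (inGadget i (tap a)) (inGadget i sink)
    hub-hubLeaf   : ∀ {i b} → Arc (inGadget i hub) (inGadget i (hubLeaf b))
    sink-sinkLeaf : ∀ {i b} → Arc (inGadget i sink) (inGadget i (sinkLeaf b))

  arc-view : ∀ x y → arc x y ≡ true → Arc x y
  arc-view (old u) (old v) h = old-old h
  arc-view (old u) (pendant b v) h with ∧-elim (u == v) h
  ... | u=v , Sv rewrite ==-sound u=v = old-pendant Sv
  arc-view (old u) (inGadget i (tap a)) h with ∧-elim (u == a) h
  ... | u=a , ta rewrite ==-sound u=a = old-tap ta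
  arc-view (old u) (inGadget i hub) h with ∧-elim (u == root (gadget i)) h
  ... | u=r , r rewrite ==-sound u=r = old-hub r
  arc-view (inGadget i (tap a)) (inGadget j hub) h with ∧-elim (i == j) h
  ... | i=j , h′ rewrite ==-sound i=j = let ta , r = ∧-elim (taps (gadget j) a) h′ in tap-hub ta r
  arc-view (inGadget i (tap a)) (inGadget j sink) h with ∧-elim (i == j) h
  ... | i=j , ta rewrite ==-sound i=j = tap-sink ta
  arc-view (inGadget i hub) (inGadget j (hubLeaf b)) h rewrite ==-sound h = hub-hubLeaf
  arc-view (inGadget i sink) (inGadget j (sinkLeaf b)) h rewrite ==-sound h = sink-sinkLeaf

  arc-irrefl : ∀ x → arc x x ≡ false
  arc-irrefl (old v)                   = irrefl G v
  arc-irrefl (pendant b v)             = refl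
  arc-irrefl (inGadget i (tap a))      = refl
  arc-irrefl (inGadget i hub)          = refl
  arc-irrefl (inGadget i sink)         = refl
  arc-irrefl (inGadget i (hubLeaf b))  = refl
  arc-irrefl (inGadget i (sinkLeaf b)) = refl

  adjacent : Vertex n ℓ → Vertex n ℓ → Bool
  adjacent x y = arc x y ∨ arc y x

  adjacent-old : ∀ u v → adjacent (old u) (old v) ≡ adj G u v
  adjacent-old u v = trans (cong (adj G u v ∨_) (Graph.sym G v u)) (∨-idem (adj G u v))

  Edge : Vertex n ℓ → Vertex n ℓ → Set
  Edge x y = Arc x y ⊎ Arc y x

  edge-view : ∀ x y → adjacent x y ≡ true → Edge x y
  edge-view x y h with ∨-elim (arc x y) h
  ... | inj₁ xy = inj₁ (arc-view x y xy)
  ... | inj₂ yx = inj₂ (arc-view y x yx)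

  extended : Graph N
  extended = record
    { adj    = λ x y → adjacent (vertex x) (vertex y)
    ; sym    = λ x y → ∨-comm (arc (vertex x) (vertex y)) _
    ; irrefl = λ x → cong₂ _∨_ (arc-irrefl (vertex x)) (arc-irrefl (vertex x))
    }

  private
    H : Graph N
    H = extended

  vertex-old : ∀ v → vertex (v ↑ˡ M) ≡ old v
  vertex-old v = decode-encode {ℓ = ℓ} (old v)

  extended-induced : IsInducedExt G extended
  extended-induced u v = trans (cong₂ adjacent (vertex-old u) (vertex-old v)) (adjacent-old u v)

  encode-injective : ∀ {k l : Vertex n ℓ} → encode k ≡ encode l → k ≡ l
  encode-injective {k} {l} e = trans (sym (decode-encode k)) (trans (cong vertex e) (decode-encode l))

  encode-vertex : ∀ x → encode (vertex x) ≡ x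
  encode-vertex = encode-decode {n} {ℓ}

  encode-inverse : ∀ {x k} → vertex x ≡ k → encode k ≡ x
  encode-inverse {x} x=k = trans (sym (cong encode x=k)) (encode-vertex x)

  vertex-↑ʳ-isOld : ∀ j → isOld (vertex (n ↑ʳ j)) ≡ false
  vertex-↑ʳ-isOld j rewrite FinP.splitAt-↑ʳ n M j with splitAt n j
  ... | inj₁ _ = refl
  ... | inj₂ j′ with splitAt n j′
  ...   | inj₁ _ = refl
  ...   | inj₂ _ = refl

  cnbr-view : ∀ x y → cnbr H x y ≡ true → x ≡ y ⊎ adjacent (vertex x) (vertex y) ≡ true
  cnbr-view x y h with x Fin.≟ y
  ... | yes x≡y = inj₁ x≡y
  ... | no _    = inj₂ h

  cnbr-encode : ∀ x k → adjacent (vertex x) k ≡ true → cnbr H x (encode k) ≡ true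
  cnbr-encode x k h = ∨-introʳ ⌊ x Fin.≟ encode k ⌋ (subst (λ l → adjacent (vertex x) l ≡ true) (sym (decode-encode k)) h)

  cnbr-old : ∀ u v → cnbr H (u ↑ˡ M) (v ↑ˡ M) ≡ cnbr G u v
  cnbr-old u v = cong₂ _∨_ same (extended-induced u v)
    where
    same : ⌊ u ↑ˡ M Fin.≟ v ↑ˡ M ⌋ ≡ (u == v)
    same with u Fin.≟ v
    ... | yes refl = ==-refl (u ↑ˡ M)
    ... | no u≢v   = ==-false (u≢v ∘ FinP.↑ˡ-injective M u v)

  cnbr-old-new : ∀ v k → isOld k ≡ false → cnbr H (v ↑ˡ M) (encode k) ≡ adjacent (old v) k
  cnbr-old-new v k k-new = cong₂ _∨_ (==-false distinct) (cong₂ adjacent (vertex-old v) (decode-encode k))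
    where
    distinct : v ↑ˡ M ≢ encode k
    distinct e = contradiction (trans (sym k-new) (cong isOld (trans (sym (decode-encode k))
                                                             (trans (cong vertex (sym e)) (vertex-old v))))) λ ()

  module Propagation (W : VSet n) where

    observedIn : Bool → Gadget S → GadgetVertex n → Bool
    observedIn fl g (tap a)      = taps g a ∧ W a
    observedIn fl g hub          = rooted g ∧ W (root g)
    observedIn fl g sink         = fl ∧ fires W g
    observedIn fl g (hubLeaf _)  = false
    observedIn fl g (sinkLeaf _) = false

    -- the shape of the observed set at every stage, given its trace B on G; fl: at least one round was made
    observed : Bool → VSet n → Vertex n ℓ → Bool
    observed fl B (old v)        = B v
    observed fl B (pendant _ v)  = W v ∧ S v
    observed fl B (inGadget i v) = observedIn fl (gadget i) v

    module Round (fl : Bool) (Bs : VSet n) (B : VSet N) (B≗ : ∀ x → B x ≡ observed fl Bs (vertex x))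
                 (W⊆Bs : W ⊆ᵥ Bs) where

      now next : Vertex n ℓ → Bool
      now  = observed fl Bs
      next = observed true (guardedStep G S W Bs)

      free : Fin N → ℕ
      free x = card (λ w → cnbr H x w ∧ not (B w))

      private
        freeAt : ∀ x k → adjacent (vertex x) k ≡ true → now k ≡ false → (cnbr H x (encode k) ∧ not (B (encode k))) ≡ true
        freeAt x k adj unobs rewrite cnbr-encode x k adj | B≗ (encode k) | decode-encode k | unobs = refl

      blocked : ∀ x {k₁ k₂} → k₁ ≢ k₂ → adjacent (vertex x) k₁ ≡ true → now k₁ ≡ false →
                adjacent (vertex x) k₂ ≡ true → now k₂ ≡ false → free x ≢ 1
      blocked x {k₁} {k₂} k₁≢k₂ adj₁ unobs₁ adj₂ unobs₂ free≡1 =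
        ℕP.<-irrefl (sym free≡1) (card-≥2 _ (encode k₁) (encode k₂) (k₁≢k₂ ∘ encode-injective)
                                           (freeAt x k₁ adj₁ unobs₁) (freeAt x k₂ adj₂ unobs₂))

      only-free : ∀ x k → B x ≡ true → adjacent (vertex x) k ≡ true → now k ≡ false →
                  (∀ l → adjacent (vertex x) l ≡ true → now l ≡ false → l ≡ k) → free x ≡ 1
      only-free x k Bx adj unobs unique = card-≡1 _ (encode k) (freeAt x k adj unobs) other
        where
        other : ∀ w → (cnbr H x w ∧ not (B w)) ≡ true → w ≡ encode k
        other w h with ∧-elim (cnbr H x w) h
        ... | xw , ¬Bw with cnbr-view x w xw
        ...   | inj₁ refl = contradiction (trans (sym Bx) (not-true ¬Bw)) λ ()
        ...   | inj₂ adj′ = sym (encode-inverse (unique (vertex w) adj′ (trans (sym (B≗ w)) (not-true ¬Bw))))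

      old-neighbour-observed : ∀ u {k} → (S u ≡ true → W u ≡ true) → isOld k ≡ false → Edge (old u) k → now k ≡ true
      old-neighbour-observed u alive new (inj₁ (old-old _))          = contradiction new λ ()
      old-neighbour-observed u alive new (inj₁ (old-pendant Su))     rewrite alive Su | Su = refl
      old-neighbour-observed u alive new (inj₁ (old-tap {i} tu))     rewrite tu | alive (taps⊆S (gadget i) u tu) = refl
      old-neighbour-observed _ alive new (inj₁ (old-hub {i} rooted)) rewrite rooted | alive (root∈S (gadget i)) = refl
      old-neighbour-observed u alive new (inj₂ (old-old _))          = contradiction new λ ()

      free-old : ∀ u → (S u ≡ true → W u ≡ true) → free (u ↑ˡ M) ≡ card (λ w → cnbr G u w ∧ not (Bs w))
      free-old u alive =
        trans (card-splitAt n _) (trans (cong₂ _+_ (card-cong oldPart) (card-false _ newPart)) (ℕP.+-identityʳ _))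
        where
        oldPart : ∀ v → (cnbr H (u ↑ˡ M) (v ↑ˡ M) ∧ not (B (v ↑ˡ M))) ≡ (cnbr G u v ∧ not (Bs v))
        oldPart v = cong₂ (λ a b → a ∧ not b) (cnbr-old u v) (trans (B≗ _) (cong now (vertex-old v)))
        newPart : ∀ j → (cnbr H (u ↑ˡ M) (n ↑ʳ j) ∧ not (B (n ↑ʳ j))) ≡ false
        newPart j with cnbr H (u ↑ˡ M) (n ↑ʳ j) in c
        ... | false = refl
        ... | true with cnbr-view _ _ c
        ...   | inj₁ e   =
          contradiction (trans (sym (vertex-↑ʳ-isOld j)) (cong isOld (trans (cong vertex (sym e)) (vertex-old u)))) λ ()
        ...   | inj₂ adj = cong not (trans (B≗ _) (old-neighbour-observed u alive (vertex-↑ʳ-isOld j)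
                             (edge-view (old u) _ (subst (λ k → adjacent k (vertex (n ↑ʳ j)) ≡ true) (vertex-old u) adj))))

      sensors-alive : ∀ x {u} → vertex x ≡ old u → free x ≡ 1 → S u ≡ true → W u ≡ true
      sensors-alive x {u} x=u free≡1 Su with W u in Wu
      ... | true  = refl
      ... | false = contradiction free≡1 (blocked x (λ ()) (leaf false) (unobserved {false}) (leaf true) (unobserved {true}))
        where
        leaf : ∀ b → adjacent (vertex x) (pendant b u) ≡ true
        leaf b rewrite x=u | ==-refl u | Su = refl
        unobserved : ∀ {b} → now (pendant b u) ≡ false
        unobserved rewrite Wu = refl

      hub-blocked : ∀ x {i} → vertex x ≡ inGadget i hub → free x ≢ 1
      hub-blocked x {i} x=hub = blocked x (λ ()) (leaf false) refl (leaf true) refl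
        where
        leaf : ∀ b → adjacent (vertex x) (inGadget i (hubLeaf b)) ≡ true
        leaf b rewrite x=hub | ==-refl i = refl

      sink-blocked : ∀ x {i} → vertex x ≡ inGadget i sink → free x ≢ 1
      sink-blocked x {i} x=sink = blocked x (λ ()) (leaf false) refl (leaf true) refl
        where
        leaf : ∀ b → adjacent (vertex x) (inGadget i (sinkLeaf b)) ≡ true
        leaf b rewrite x=sink | ==-refl i = refl

      -- a tap sees both the hub and the sink unobserved while the root's sensors all failed
      tap-blocked : ∀ x {i a} → vertex x ≡ inGadget i (tap a) → taps (gadget i) a ≡ true → rooted (gadget i) ≡ true →
                    W (root (gadget i)) ≡ false → free x ≢ 1
      tap-blocked x {i} {a} x=tap ta rt ¬Wr = blocked x (λ ()) toHub hubUnobserved toSink sinkUnobserved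
        where
        toHub : adjacent (vertex x) (inGadget i hub) ≡ true
        toHub rewrite x=tap | ==-refl i | ta | rt = refl
        toSink : adjacent (vertex x) (inGadget i sink) ≡ true
        toSink rewrite x=tap | ==-refl i | ta = refl
        hubUnobserved : now (inGadget i hub) ≡ false
        hubUnobserved rewrite rt | ¬Wr = refl
        sinkUnobserved : now (inGadget i sink) ≡ false
        sinkUnobserved rewrite rt | ¬Wr | ∧-zeroʳ (meets (taps (gadget i)) W) = ∧-zeroʳ fl

      root-alive : ∀ x {i a} → vertex x ≡ inGadget i (tap a) → taps (gadget i) a ≡ true → free x ≡ 1 →
                   rooted (gadget i) ≡ true → W (root (gadget i)) ≡ true
      root-alive x {i} x=tap ta free≡1 rt with W (root (gadget i)) in Wr
      ... | true  = refl
      ... | false = contradiction free≡1 (tap-blocked x x=tap ta rt Wr)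

      force-old : ∀ x {u v} → vertex x ≡ old u → Bs u ≡ true → adj G u v ≡ true → free x ≡ 1 → next (old v) ≡ true
      force-old x {u} {v} x=u Bu uv free≡1 =
        ∨-introʳ (Bs v) (anyF-intro _ u (∧-intro Bu (∧-intro (∨-introʳ (u == v) uv)
          (∧-intro (⇒ᵇ-intro (S u) (sensors-alive x x=u free≡1)) (≟-complete freeG≡1)))))
        where
        freeG≡1 : card (λ w → cnbr G u w ∧ not (Bs w)) ≡ 1
        freeG≡1 = begin
          card (λ w → cnbr G u w ∧ not (Bs w)) ≡⟨ free-old u (sensors-alive x x=u free≡1) ⟨
          free (u ↑ˡ M)                        ≡⟨ cong free (encode-inverse x=u) ⟩
          free x                               ≡⟨ free≡1 ⟩
          1                                    ∎
          where open ≡-Reasoning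

      force : ∀ x {k l} → vertex x ≡ k → now k ≡ true → Edge k l → free x ≡ 1 → next l ≡ true
      force x x=k obs (inj₁ (old-old uv))            free≡1 = force-old x x=k obs uv free≡1
      force x x=k obs (inj₂ (old-old {u} {v} vu))     free≡1 = force-old x x=k obs (trans (Graph.sym G v u) vu) free≡1
      force x x=k obs (inj₁ (old-pendant Sv))        free≡1 = ∧-intro (sensors-alive x x=k free≡1 Sv) Sv
      force x x=k obs (inj₁ (old-tap {i} {a} ta))    free≡1 = ∧-intro ta (sensors-alive x x=k free≡1 (taps⊆S (gadget i) a ta))
      force x x=k obs (inj₁ (old-hub {i} rt))        free≡1 = ∧-intro rt (sensors-alive x x=k free≡1 (root∈S (gadget i)))
      force x x=k obs (inj₁ (tap-hub ta rt))         free≡1 = ∧-intro rt (root-alive x x=k ta free≡1 rt)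
      force x x=k obs (inj₁ (tap-sink {i} {a} ta))   free≡1 =
        ∧-intro (anyF-intro (λ v → taps (gadget i) v ∧ W v) a obs) (⇒ᵇ-intro (rooted (gadget i)) (root-alive x x=k ta free≡1))
      force x x=k obs (inj₁ hub-hubLeaf)             free≡1 = contradiction free≡1 (hub-blocked x x=k)
      force x x=k obs (inj₁ sink-sinkLeaf)           free≡1 = contradiction free≡1 (sink-blocked x x=k)
      force x x=k obs (inj₂ (old-pendant {v} Sv))    free≡1 = ∨-introˡ _ (W⊆Bs v (proj₁ (∧-elim (W v) obs)))
      force x x=k obs (inj₂ (old-tap {i} {a} ta))    free≡1 = ∨-introˡ _ (W⊆Bs a (proj₂ (∧-elim (taps (gadget i) a) obs)))
      force x x=k obs (inj₂ (old-hub {i} rt))        free≡1 = ∨-introˡ _ (W⊆Bs _ (proj₂ (∧-elim (rooted (gadget i)) obs)))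
      force x x=k obs (inj₂ (tap-hub ta rt))         free≡1 = contradiction free≡1 (hub-blocked x x=k)
      force x x=k obs (inj₂ (tap-sink ta))           free≡1 = contradiction free≡1 (sink-blocked x x=k)
      force x x=k ()  (inj₂ hub-hubLeaf)             free≡1
      force x x=k ()  (inj₂ sink-sinkLeaf)           free≡1

      now⊆next : ∀ k → now k ≡ true → next k ≡ true
      now⊆next (old v)              obs = ∨-introˡ _ obs
      now⊆next (pendant b v)        obs = obs
      now⊆next (inGadget i (tap a)) obs = obs
      now⊆next (inGadget i hub)     obs = obs
      now⊆next (inGadget i sink)    obs = proj₂ (∧-elim fl obs)

      propStep⊆next : ∀ y → propStep H B y ≡ true → next (vertex y) ≡ true
      propStep⊆next y h with ∨-elim (B y) h
      ... | inj₁ By = now⊆next (vertex y) (trans (sym (B≗ y)) By)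
      ... | inj₂ forced with anyF-elim _ forced
      ...   | x , px with ∧-elim (B x) px
      ...     | Bx , rest with ∧-elim (cnbr H x y) rest
      ...       | xy , free≡1 with cnbr-view x y xy
      ...         | inj₁ refl = now⊆next (vertex x) (trans (sym (B≗ x)) Bx)
      ...         | inj₂ adj  = force x refl (trans (sym (B≗ x)) Bx) (edge-view _ _ adj) (≟-sound free≡1)

      private
        already : ∀ y {k} → vertex y ≡ k → now k ≡ true → propStep H B y ≡ true
        already y y=k obs = ∨-introˡ _ (trans (B≗ y) (trans (cong now y=k) obs))

        forced-by : ∀ x y → B x ≡ true → cnbr H x y ≡ true → free x ≡ 1 → propStep H B y ≡ true
        forced-by x y Bx xy free≡1 = ∨-introʳ (B y) (anyF-intro _ x (∧-intro Bx (∧-intro xy (≟-complete free≡1))))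

      old-forced : ∀ y {u v} → vertex y ≡ old v → Bs u ≡ true → cnbr G u v ≡ true → (S u ≡ true → W u ≡ true) →
                   card (λ w → cnbr G u w ∧ not (Bs w)) ≡ 1 → propStep H B y ≡ true
      old-forced y {u} {v} y=v Bu uv alive freeG≡1 = forced-by x y Bx xy (trans (free-old u alive) freeG≡1)
        where
        x : Fin N
        x = u ↑ˡ M
        Bx : B x ≡ true
        Bx = trans (B≗ x) (trans (cong now (vertex-old u)) Bu)
        xy : cnbr H x y ≡ true
        xy = subst (λ z → cnbr H x z ≡ true) (encode-inverse y=v) (trans (cnbr-old u v) uv)

      -- the witness tap sees only the sink unobserved: its old vertex and the hub are observed
      sink-forced : ∀ y {i a} → vertex y ≡ inGadget i sink → now (inGadget i sink) ≡ false →
                    now (inGadget i (tap a)) ≡ true → (rooted (gadget i) ⇒ᵇ W (root (gadget i))) ≡ true →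
                    propStep H B y ≡ true
      sink-forced y {i} {a} y=sink unobserved tapObserved rootAlive =
        forced-by x y Bx xy (only-free x (inGadget i sink) Bx toSink unobserved unique)
        where
        x : Fin N
        x = encode (inGadget i (tap a))
        ta : taps (gadget i) a ≡ true
        ta = proj₁ (∧-elim (taps (gadget i) a) tapObserved)
        Bx : B x ≡ true
        Bx = trans (B≗ x) (trans (cong now (decode-encode (inGadget i (tap a)))) tapObserved)
        toSink : adjacent (vertex x) (inGadget i sink) ≡ true
        toSink rewrite decode-encode (inGadget i (tap a)) | ==-refl i | ta = refl
        xy : cnbr H x y ≡ true
        xy = subst (λ z → cnbr H x z ≡ true) (encode-inverse y=sink) (cnbr-encode x _ toSink)
        unique′ : ∀ {l} → Edge (inGadget i (tap a)) l → now l ≡ false → l ≡ inGadget i sink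
        unique′ (inj₁ (tap-hub _ rt)) unobs = contradiction (trans (sym unobs) (∧-intro rt (⇒ᵇ-elim rootAlive rt))) λ ()
        unique′ (inj₁ (tap-sink _))   unobs = refl
        unique′ (inj₂ (old-tap _))    unobs =
          contradiction (trans (sym unobs) (W⊆Bs a (proj₂ (∧-elim (taps (gadget i) a) tapObserved)))) λ ()
        unique : ∀ l → adjacent (vertex x) l ≡ true → now l ≡ false → l ≡ inGadget i sink
        unique l adj = unique′ (edge-view _ l (subst (λ k → adjacent k l ≡ true) (decode-encode (inGadget i (tap a))) adj))

      next⊆propStep : ∀ y {k} → vertex y ≡ k → next k ≡ true → propStep H B y ≡ true
      next⊆propStep y {old v} y=v obs with ∨-elim (Bs v) obs
      ... | inj₁ Bv = already y y=v Bv
      ... | inj₂ forced with anyF-elim _ forced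
      ...   | u , pu with ∧-elim (Bs u) pu
      ...     | Bu , rest with ∧-elim (cnbr G u v) rest
      ...       | uv , rest′ with ∧-elim (S u ⇒ᵇ W u) rest′
      ...         | alive , freeG≡1 = old-forced y y=v Bu uv (⇒ᵇ-elim alive) (≟-sound freeG≡1)
      next⊆propStep y {pendant b v}        y=k obs = already y y=k obs
      next⊆propStep y {inGadget i (tap a)} y=k obs = already y y=k obs
      next⊆propStep y {inGadget i hub}     y=k obs = already y y=k obs
      next⊆propStep y {inGadget i sink}    y=k obs with fl ∧ fires W (gadget i) in fired
      ... | true  = already y y=k fired
      ... | false with ∧-elim (meets (taps (gadget i)) W) obs
      ...   | tapped , rootAlive with anyF-elim (λ v → taps (gadget i) v ∧ W v) tapped
      ...     | a , tapObserved = sink-forced y y=k fired tapObserved rootAlive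

      step : ∀ y → propStep H B y ≡ next (vertex y)
      step y = ⇔⇒≡ (propStep⊆next y) (next⊆propStep y refl)

    closedN-lift : ∀ y → closedN H (liftSet M W) y ≡ observed false (closedN G W) (vertex y)
    closedN-lift y = begin
      closedN H (liftSet M W) y
        ≡⟨ anyF-splitAt {m = M} n _ ⟩
      anyF (λ (v : Fin n) → liftSet M W (v ↑ˡ M) ∧ cnbr H (v ↑ˡ M) y)
        ∨ anyF (λ (j : Fin M) → liftSet M W (n ↑ʳ j) ∧ cnbr H (n ↑ʳ j) y)
        ≡⟨ cong₂ _∨_ (anyF-cong λ v → cong (_∧ cnbr H (v ↑ˡ M) y) (cong [ W , const false ]′ (FinP.splitAt-↑ˡ n v M)))
                     (anyF-false _ λ j → cong (_∧ cnbr H (n ↑ʳ j) y) (cong [ W , const false ]′ (FinP.splitAt-↑ʳ n M j))) ⟩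
      anyF (λ (v : Fin n) → W v ∧ cnbr H (v ↑ˡ M) y) ∨ false
        ≡⟨ ∨-identityʳ _ ⟩
      anyF (λ (v : Fin n) → W v ∧ cnbr H (v ↑ˡ M) y)
        ≡⟨ cong (λ z → anyF (λ (v : Fin n) → W v ∧ cnbr H (v ↑ˡ M) z)) (sym (encode-vertex y)) ⟩
      anyF (λ (v : Fin n) → W v ∧ cnbr H (v ↑ˡ M) (encode (vertex y)))
        ≡⟨ byVertex (vertex y) ⟩
      observed false (closedN G W) (vertex y) ∎
      where
      open ≡-Reasoning
      viaAdjacent : ∀ k → isOld k ≡ false →
                    anyF (λ v → W v ∧ cnbr H (v ↑ˡ M) (encode k)) ≡ anyF (λ v → W v ∧ (arc (old v) k ∨ arc k (old v)))
      viaAdjacent k new = anyF-cong λ v → cong (W v ∧_) (cnbr-old-new v k new)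
      byVertex : ∀ k → anyF (λ v → W v ∧ cnbr H (v ↑ˡ M) (encode k)) ≡ observed false (closedN G W) k
      byVertex (old u)                  = anyF-cong λ v → cong (W v ∧_) (cnbr-old v u)
      byVertex (pendant b w)            =
        trans (viaAdjacent (pendant b w) refl) (trans (anyF-cong λ v → cong (W v ∧_) (∨-identityʳ _)) (anyF-== W w (S w)))
      byVertex (inGadget i (tap a))     =
        trans (viaAdjacent (inGadget i (tap a)) refl) (trans (anyF-cong λ v → cong (W v ∧_) (∨-identityʳ _))
              (trans (anyF-== W a (taps (gadget i) a)) (∧-comm (W a) _)))
      byVertex (inGadget i hub)         =
        trans (viaAdjacent (inGadget i hub) refl) (trans (anyF-cong λ v → cong (W v ∧_) (∨-identityʳ _))
              (trans (anyF-== W (root (gadget i)) (rooted (gadget i))) (∧-comm (W (root (gadget i))) _)))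
      byVertex (inGadget i sink)         = trans (viaAdjacent (inGadget i sink) refl) (anyF-false _ λ v → ∧-zeroʳ (W v))
      byVertex (inGadget i (hubLeaf b))  = trans (viaAdjacent (inGadget i (hubLeaf b)) refl) (anyF-false _ λ v → ∧-zeroʳ (W v))
      byVertex (inGadget i (sinkLeaf b)) = trans (viaAdjacent (inGadget i (sinkLeaf b)) refl) (anyF-false _ λ v → ∧-zeroʳ (W v))

    rounds : ℕ → VSet n
    rounds t = iter t (guardedStep G S W) (closedN G W)

    W⊆rounds : ∀ t → W ⊆ᵥ rounds t
    W⊆rounds zero    v Wv = anyF-intro _ v (∧-intro Wv (∨-introˡ _ (==-refl v)))
    W⊆rounds (suc t) v Wv = guardedStep-inflationary G S W (rounds t) v (W⊆rounds t v Wv)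

    started : ℕ → Bool
    started zero    = false
    started (suc _) = true

    invariant : ∀ t y → iter t (propStep H) (closedN H (liftSet M W)) y ≡ observed (started t) (rounds t) (vertex y)
    invariant zero    = closedN-lift
    invariant (suc t) = Round.step (started t) (rounds t) _ (invariant t) (W⊆rounds t)

    card-observedIn : ∀ fl g → card (λ z → observedIn fl g (decodeGadgetVertex z)) ≡ gadgetCount W fl g
    card-observedIn fl g =
      trans (card-[,]∘splitAt n (observedIn fl g) tap special)
            (cong (λ k → card (λ a → taps g a ∧ W a) + (𝟙ℕ (rooted g ∧ W (root g)) + k)) (ℕP.+-identityʳ _))

    card-observed : ∀ fl B → card (λ y → observed fl B (vertex y))
                    ≡ card B + (card (λ v → W v ∧ S v) + (card (λ v → W v ∧ S v) + sum (map (gadgetCount W fl) gs)))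
    card-observed fl B =
      trans (card-[,]∘splitAt n (observed fl B) old _)
        (cong (card B ℕ.+_) (trans (card-[,]∘splitAt n (observed fl B) (pendant false) _)
          (cong (card (λ v → W v ∧ S v) ℕ.+_) (trans (card-[,]∘splitAt n (observed fl B) (pendant true) _)
            (cong (card (λ v → W v ∧ S v) ℕ.+_) (trans (card-remQuot gs (n + 6) (λ g z → observedIn fl g (decodeGadgetVertex z)))
              (cong sum (map-cong (card-observedIn fl) gs))))))))

    -- Obs makes n + M rounds, at least one as soon as there is a gadget, so every sink has had its round
    gadgets-started : ∀ (hs : List (Gadget S)) →
                      sum (map (gadgetCount W (started (n + extraVertices n (length hs)))) hs) ≡ sum (map (gadgetCount W true) hs)
    gadgets-started []       = refl
    gadgets-started (h ∷ hs) = cong (λ fl → sum (map (gadgetCount W fl) (h ∷ hs)))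
      (startedʳ n (startedʳ n (startedʳ n (startedˡ (length hs * (n + 6)) (startedʳ n refl)))))
      where
      startedʳ : ∀ a {b} → started b ≡ true → started (a + b) ≡ true
      startedʳ zero    sb = sb
      startedʳ (suc a) _  = refl
      startedˡ : ∀ {a} b → started a ≡ true → started (a + b) ≡ true
      startedˡ {suc a} b _ = refl

    card-Obs : card (Obs H (liftSet M W))
               ≡ card (rounds n) + (card (λ v → W v ∧ S v) + (card (λ v → W v ∧ S v) + sum (map (gadgetCount W true) gs)))
    card-Obs = begin
      card (Obs H (liftSet M W))
        ≡⟨ card-cong (invariant N) ⟩
      card (λ y → observed (started N) (rounds N) (vertex y))
        ≡⟨ card-observed (started N) (rounds N) ⟩
      card (rounds N) + (card (λ v → W v ∧ S v) + (card (λ v → W v ∧ S v) + sum (map (gadgetCount W (started N)) gs)))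
        ≡⟨ cong₂ (λ a b → a + (card (λ v → W v ∧ S v) + (card (λ v → W v ∧ S v) + b)))
                 (card-cong (iter-stable (guardedStep G S W) (guardedStep-cong G S W) (guardedStep-inflationary G S W) (closedN G W) M))
                 (gadgets-started gs) ⟩
      card (rounds n) + (card (λ v → W v ∧ S v) + (card (λ v → W v ∧ S v) + sum (map (gadgetCount W true) gs))) ∎
      where open ≡-Reasoning

module _ {n} {S : VSet n} (f : Fin n → ℕ) where

  𝔼-meets-above : ∀ {X j} → X ⊆ᵥ S → fsum f X < j → 𝔼 S f (λ W → 𝟙 (meets X W)) j ≡ + 0
  𝔼-meets-above {X} {j} X⊆S fX<j = trans (𝔼-meets S X f X⊆S j) (cong₂ _-_ (δ-< (ℕP.≤-<-trans z≤n fX<j)) (δ-< fX<j))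

  𝔼-meets-high : ∀ {X j} → X ⊆ᵥ S → 1 ≤ j → 𝔼 S f (λ W → 𝟙 (meets X W)) j ≡ - δ (fsum f X) j
  𝔼-meets-high {X} {j} X⊆S 1≤j =
    trans (𝔼-meets S X f X⊆S j) (trans (cong (_- δ (fsum f X) j) (δ-< 1≤j)) (ℤP.+-identityˡ _))

  𝔼-member-above : ∀ {a j} → S a ≡ true → f a < j → 𝔼 S f (λ W → 𝟙 (W a)) j ≡ + 0
  𝔼-member-above {a} {j} Sa fa<j = trans (𝔼-member S f Sa j) (cong₂ _-_ (δ-< (ℕP.≤-<-trans z≤n fa<j)) (δ-< fa<j))

  𝔼-card-above : ∀ {P : VSet n} {j} → P ⊆ᵥ S → (∀ a → P a ≡ true → f a < j) →
                 𝔼 S f (λ W → + card (λ a → P a ∧ W a)) j ≡ + 0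
  𝔼-card-above {P} {j} P⊆S below = 𝔼-card S f (λ a W → P a ∧ W a) j each
    where
    each : ∀ a → 𝔼 S f (λ W → 𝟙 (P a ∧ W a)) j ≡ + 0
    each a with P a in Pa
    ... | true  = 𝔼-member-above (P⊆S a Pa) (below a Pa)
    ... | false = 𝔼-0 S f j

infixl 30 _∖｛_｝
_∖｛_｝ : VSet n → Fin n → VSet n
(T ∖｛ r ｝) v = T v ∧ not (v == r)

module _ {n} {S T : VSet n} (T⊆S : T ⊆ᵥ S) {r : Fin n} (Tr : T r ≡ true) where

  T∖r⊆S : T ∖｛ r ｝ ⊆ᵥ S
  T∖r⊆S v h = T⊆S v (proj₁ (∧-elim (T v) h))

  negativeGadget positiveGadget : Gadget S
  negativeGadget = record { taps = T ; taps⊆S = T⊆S ; rooted = false ; root = r ; root∈S = T⊆S r Tr }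
  positiveGadget = record { taps = T ∖｛ r ｝ ; taps⊆S = T∖r⊆S ; rooted = true ; root = r ; root∈S = T⊆S r Tr }

  meets-∖｛｝ : ∀ W → meets (T ∖｛ r ｝) W ∨ W r ≡ meets T W
  meets-∖｛｝ W = ⇔⇒≡ to from
    where
    to : meets (T ∖｛ r ｝) W ∨ W r ≡ true → meets T W ≡ true
    to h with ∨-elim (meets (T ∖｛ r ｝) W) h
    ... | inj₂ Wr = anyF-intro _ r (∧-intro Tr Wr)
    ... | inj₁ m with anyF-elim _ m
    ...   | v , pv = let T∖rv , Wv = ∧-elim ((T ∖｛ r ｝) v) pv in anyF-intro _ v (∧-intro (proj₁ (∧-elim (T v) T∖rv)) Wv)
    from : meets T W ≡ true → meets (T ∖｛ r ｝) W ∨ W r ≡ true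
    from h with anyF-elim _ h
    ... | v , pv with ∧-elim (T v) pv | v == r in v=r
    ...   | Tv , Wv | true  rewrite ==-sound v=r = ∨-introʳ (meets (T ∖｛ r ｝) W) Wv
    ...   | Tv , Wv | false = ∨-introˡ _ (anyF-intro _ v (∧-intro (∧-intro Tv (cong not v=r)) Wv))

  module _ (f : Fin n → ℕ) (f≥1 : ∀ s → S s ≡ true → 1 ≤ f s) where

    fsum-T : fsum f T ≡ f r + fsum f (T ∖｛ r ｝)
    fsum-T = trans (fsum-partition f T (λ v → v == r)) (cong (_+ fsum f (T ∖｛ r ｝))
      (fsum-singleton f _ r (∧-intro Tr (==-refl r)) λ v h → ==-sound (proj₂ (∧-elim (T v) h))))

    module _ (2≤T : 2 ≤ card T) where

      rest≥1 : 1 ≤ fsum f (T ∖｛ r ｝)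
      rest≥1 = ℕP.≤-trans (f≥1 a (T∖r⊆S a a∈)) (fsum-≥ f (T ∖｛ r ｝) a a∈)
        where
        just-r : card (λ v → T v ∧ (v == r)) ≡ 1
        just-r = card-≡1 _ r (∧-intro Tr (==-refl r)) λ v h → ==-sound (proj₂ (∧-elim (T v) h))
        nonempty : 1 ≤ card (T ∖｛ r ｝)
        nonempty = ℕP.+-cancelˡ-≤ 1 1 _
          (subst (2 ≤_) (trans (card-partition T (λ v → v == r)) (cong (_+ card (T ∖｛ r ｝)) just-r)) 2≤T)
        a : Fin n
        a = proj₁ (card-≥1⇒∃ (T ∖｛ r ｝) nonempty)
        a∈ : (T ∖｛ r ｝) a ≡ true
        a∈ = proj₂ (card-≥1⇒∃ (T ∖｛ r ｝) nonempty)

      fr<fT : f r < fsum f T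
      fr<fT = subst (f r <_) (sym fsum-T)
                    (subst (_≤ f r + fsum f (T ∖｛ r ｝)) (ℕP.+-comm (f r) 1) (ℕP.+-monoʳ-≤ (f r) rest≥1))

      frest<fT : fsum f (T ∖｛ r ｝) < fsum f T
      frest<fT = subst (fsum f (T ∖｛ r ｝) <_) (sym fsum-T) (ℕP.+-monoˡ-≤ (fsum f (T ∖｛ r ｝)) (f≥1 r (T⊆S r Tr)))

      member<fT : ∀ a → T a ≡ true → f a < fsum f T
      member<fT a Ta with a == r in a=r
      ... | true  rewrite ==-sound a=r = fr<fT
      ... | false = ℕP.≤-<-trans (fsum-≥ f (T ∖｛ r ｝) a (∧-intro Ta (cong not a=r))) frest<fT

      𝔼-negativeGadget : ∀ j → fsum f T ≤ j → 𝔼 S f (λ W → + gadgetCount W true negativeGadget) j ≡ - δ (fsum f T) j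
      𝔼-negativeGadget j fT≤j = begin
        𝔼 S f (λ W → + gadgetCount W true negativeGadget) j
          ≡⟨ 𝔼-cong S f count j ⟩
        𝔼 S f (λ W → + card (λ a → T a ∧ W a) ℤ.+ 𝟙 (meets T W)) j
          ≡⟨ 𝔼-+ S f (λ W → + card (λ a → T a ∧ W a)) (λ W → 𝟙 (meets T W)) j ⟩
        𝔼 S f (λ W → + card (λ a → T a ∧ W a)) j ℤ.+ 𝔼 S f (λ W → 𝟙 (meets T W)) j
          ≡⟨ cong₂ ℤ._+_ (𝔼-card-above f T⊆S λ a Ta → ℕP.<-≤-trans (member<fT a Ta) fT≤j)
                         (𝔼-meets-high f T⊆S (ℕP.≤-trans (ℕP.≤-<-trans z≤n fr<fT) fT≤j)) ⟩
        + 0 ℤ.+ - δ (fsum f T) j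
          ≡⟨ ℤP.+-identityˡ _ ⟩
        - δ (fsum f T) j ∎
        where
        open ≡-Reasoning
        count : ∀ W → + gadgetCount W true negativeGadget ≡ + card (λ a → T a ∧ W a) ℤ.+ 𝟙 (meets T W)
        count W = trans (ℤP.pos-+ (card (λ a → T a ∧ W a)) _) (cong (λ z → + card (λ a → T a ∧ W a) ℤ.+ z)
                        (trans (+𝟙ℕ _) (cong 𝟙 (∧-identityʳ (meets T W)))))

      -- inclusion–exclusion: [A ∩ W ≠ ∅ ∧ r ∈ W] = [A ∩ W ≠ ∅] + [r ∈ W] − [T ∩ W ≠ ∅] for A = T ∖ {r}
      𝔼-positiveGadget : ∀ j → fsum f T ≤ j → 𝔼 S f (λ W → + gadgetCount W true positiveGadget) j ≡ δ (fsum f T) j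
      𝔼-positiveGadget j fT≤j = begin
        𝔼 S f (λ W → + gadgetCount W true positiveGadget) j
          ≡⟨ 𝔼-cong S f count j ⟩
        𝔼 S f (λ W → c₁ W ℤ.+ (c₂ W ℤ.+ ((c₃ W ℤ.+ c₂ W) ℤ.+ - c₄ W))) j
          ≡⟨ 𝔼-+ S f c₁ (λ W → c₂ W ℤ.+ ((c₃ W ℤ.+ c₂ W) ℤ.+ - c₄ W)) j ⟩
        𝔼 S f c₁ j ℤ.+ 𝔼 S f (λ W → c₂ W ℤ.+ ((c₃ W ℤ.+ c₂ W) ℤ.+ - c₄ W)) j
          ≡⟨ cong (λ z → 𝔼 S f c₁ j ℤ.+ z)
               (trans (𝔼-+ S f c₂ (λ W → (c₃ W ℤ.+ c₂ W) ℤ.+ - c₄ W) j) (cong (λ z → 𝔼 S f c₂ j ℤ.+ z)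
                 (trans (𝔼-+ S f (λ W → c₃ W ℤ.+ c₂ W) (λ W → - c₄ W) j)
                        (cong₂ ℤ._+_ (𝔼-+ S f c₃ c₂ j) (𝔼-neg S f c₄ j))))) ⟩
        𝔼 S f c₁ j ℤ.+ (𝔼 S f c₂ j ℤ.+ ((𝔼 S f c₃ j ℤ.+ 𝔼 S f c₂ j) ℤ.+ - 𝔼 S f c₄ j))
          ≡⟨ cong₂ ℤ._+_ e₁ (cong₂ ℤ._+_ e₂ (cong₂ ℤ._+_ (cong₂ ℤ._+_ e₃ e₂) (cong -_ e₄))) ⟩
        + 0 ℤ.+ (+ 0 ℤ.+ ((+ 0 ℤ.+ + 0) ℤ.+ - - δ (fsum f T) j))
          ≡⟨ solve 1 (λ x → con (+ 0) :+ (con (+ 0) :+ ((con (+ 0) :+ con (+ 0)) :+ :- (:- x))) := x) refl (δ (fsum f T) j) ⟩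
        δ (fsum f T) j ∎
        where
        open ≡-Reasoning
        c₁ c₂ c₃ c₄ : VSet n → ℤ
        c₁ W = + card (λ a → (T ∖｛ r ｝) a ∧ W a)
        c₂ W = 𝟙 (W r)
        c₃ W = 𝟙 (meets (T ∖｛ r ｝) W)
        c₄ W = 𝟙 (meets T W)
        count : ∀ W → + gadgetCount W true positiveGadget ≡ c₁ W ℤ.+ (c₂ W ℤ.+ ((c₃ W ℤ.+ c₂ W) ℤ.+ - c₄ W))
        count W = trans (ℤP.pos-+ (card (λ a → (T ∖｛ r ｝) a ∧ W a)) _) (cong (λ z → c₁ W ℤ.+ z)
                  (trans (ℤP.pos-+ (𝟙ℕ (W r)) _) (cong₂ ℤ._+_ (+𝟙ℕ (W r))
                  (trans (+𝟙ℕ _) (trans (𝟙-∧ (meets (T ∖｛ r ｝) W) (W r))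
                                        (cong (λ b → c₃ W ℤ.+ c₂ W - 𝟙 b) (meets-∖｛｝ W)))))))
        j≥1 : 1 ≤ j
        j≥1 = ℕP.≤-trans (ℕP.≤-<-trans z≤n fr<fT) fT≤j
        e₁ : 𝔼 S f c₁ j ≡ + 0
        e₁ = 𝔼-card-above f T∖r⊆S λ a h → ℕP.<-≤-trans (member<fT a (proj₁ (∧-elim (T a) h))) fT≤j
        e₂ : 𝔼 S f c₂ j ≡ + 0
        e₂ = 𝔼-member-above f (T⊆S r Tr) (ℕP.<-≤-trans fr<fT fT≤j)
        e₃ : 𝔼 S f c₃ j ≡ + 0
        e₃ = 𝔼-meets-above f T∖r⊆S (ℕP.<-≤-trans frest<fT fT≤j)
        e₄ : 𝔼 S f c₄ j ≡ - δ (fsum f T) j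
        e₄ = 𝔼-meets-high f T⊆S j≥1

module _ {n} (G : Graph n) (S : VSet n) (f : Fin n → ℕ) where

  baseCount : VSet n → ℕ
  baseCount W = card (iter n (guardedStep G S W) (closedN G W)) + (card (λ v → W v ∧ S v) + card (λ v → W v ∧ S v))

  coefficient : List (Gadget S) → ℕ → ℤ
  coefficient gs j = 𝔼 S f (λ W → + baseCount W) j ℤ.+ sumOver gs λ g → 𝔼 S f (λ W → + gadgetCount W true g) j

  coeff-extended : ∀ gs → let open Extension G S gs in
    coeff (expectedObs extended (liftSet (extraVertices n ℓ) S) (liftMult (extraVertices n ℓ) f)) ≗ coefficient gs
  coeff-extended gs j = begin
    coeff (expectedObs extended (liftSet M S) (liftMult M f)) j
      ≡⟨ coeff-expectedObs extended (liftSet M S) (liftMult M f) j ⟩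
    𝔼 (liftSet M S) (liftMult M f) (λ T → + card (Obs extended T)) j
      ≡⟨ 𝔼-liftSet n M S f (λ T → + card (Obs extended T)) (cong +_ ∘ card-cong ∘ Obs-cong extended) j ⟩
    𝔼 S f (λ W → + card (Obs extended (liftSet M W))) j
      ≡⟨ 𝔼-cong S f count j ⟩
    𝔼 S f (λ W → + baseCount W ℤ.+ + sum (map (λ g → gadgetCount W true g) gs)) j
      ≡⟨ 𝔼-+ S f (λ W → + baseCount W) (λ W → + sum (map (λ g → gadgetCount W true g) gs)) j ⟩
    𝔼 S f (λ W → + baseCount W) j ℤ.+ 𝔼 S f (λ W → + sum (map (λ g → gadgetCount W true g) gs)) j
      ≡⟨ cong (λ z → 𝔼 S f (λ W → + baseCount W) j ℤ.+ z) (𝔼-sum S f (λ W g → gadgetCount W true g) gs j) ⟩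
    coefficient gs j ∎
    where
    open ≡-Reasoning
    open Extension G S gs
    M : ℕ
    M = extraVertices n ℓ
    count : ∀ W → + card (Obs extended (liftSet M W)) ≡ + baseCount W ℤ.+ + sum (map (λ g → gadgetCount W true g) gs)
    count W = trans (cong +_ (trans (Propagation.card-Obs W) (regroup (card (Propagation.rounds W n)) (card (λ v → W v ∧ S v)) _)))
                    (ℤP.pos-+ (baseCount W) _)
      where
      regroup : ∀ a b s → a + (b + (b + s)) ≡ a + (b + b) + s
      regroup a b s = trans (cong (a ℕ.+_) (sym (ℕP.+-assoc b b s))) (sym (ℕP.+-assoc a (b + b) s))

-- Fixing the coefficients from the top degree down

module _ {n} (G : Graph n) (S : VSet n) (f : Fin n → ℕ) (f≥1 : ∀ s → S s ≡ true → 1 ≤ f s) (c : ℕ → ℤ) where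

  CorrectFrom : ℕ → List (Gadget S) → Set
  CorrectFrom D gs = ∀ P → P ⊆ᵥ S → 2 ≤ card P → D ≤ fsum f P → coefficient G S f gs (fsum f P) ≡ c (fsum f P)

  Realises : ℕ → VSet n → Set
  Realises D T = T ⊆ᵥ S × 2 ≤ card T × fsum f T ≡ D

  Realises-cong : ∀ {D A B} → A ≗ B → Realises D A → Realises D B
  Realises-cong {A = A} {B} A≗B (A⊆S , 2≤A , fA) =
    (λ v Bv → A⊆S v (trans (A≗B v) Bv)) , subst (2 ≤_) (card-cong A≗B) 2≤A , trans (sym (fsum-cong f A≗B)) fA

  realises? : ∀ D → Dec (∃ (Realises D))
  realises? D = map′ (λ (s , r) → Vec.lookup s , r) (λ (T , r) → Vec.tabulate T , Realises-cong (sym ∘ lookup∘tabulate T) r)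
                     (anySubset? λ s → decide (Vec.lookup s))
    where
    decide : ∀ T → Dec (Realises D T)
    decide T = FinP.all? (λ v → (T v Bool.≟ true) →-dec (S v Bool.≟ true)) ×-dec 2 ℕ.≤? card T ×-dec fsum f T ℕ.≟ D

  private
    𝔼g : Gadget S → ℕ → ℤ
    𝔼g g j = 𝔼 S f (λ W → + gadgetCount W true g) j

  coefficient-++ : ∀ k g gs j → coefficient G S f (replicate k g ++ gs) j ≡ coefficient G S f gs j ℤ.+ + k ℤ.* 𝔼g g j
  coefficient-++ k g gs j = begin
    𝔼b ℤ.+ sumOver (replicate k g ++ gs) (λ g → 𝔼g g j)
      ≡⟨ cong (λ z → 𝔼b ℤ.+ z) (sumOver-++ (replicate k g) gs _) ⟩
    𝔼b ℤ.+ (sumOver (replicate k g) (λ g → 𝔼g g j) ℤ.+ sumOver gs (λ g → 𝔼g g j))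
      ≡⟨ cong (λ z → 𝔼b ℤ.+ (z ℤ.+ _)) (sumOver-replicate k g _) ⟩
    𝔼b ℤ.+ (+ k ℤ.* 𝔼g g j ℤ.+ sumOver gs (λ g → 𝔼g g j))
      ≡⟨ solve 3 (λ b x s → b :+ (x :+ s) := (b :+ s) :+ x) refl 𝔼b _ _ ⟩
    𝔼b ℤ.+ sumOver gs (λ g → 𝔼g g j) ℤ.+ + k ℤ.* 𝔼g g j ∎
    where
    open ≡-Reasoning
    𝔼b : ℤ
    𝔼b = 𝔼 S f (λ W → + baseCount G S f W) j

  add-copies : ∀ {D gs} k g (s : ℤ) → (∀ j → D ≤ j → 𝔼g g j ≡ s ℤ.* δ D j) →
               coefficient G S f gs D ℤ.+ + k ℤ.* s ≡ c D → CorrectFrom (suc D) gs → CorrectFrom D (replicate k g ++ gs)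
  add-copies {D} {gs} k g s 𝔼g≡ fixed correct P P⊆S 2≤P D≤fP with ℕP.m≤n⇒m<n∨m≡n D≤fP
  ... | inj₁ D<fP = begin
    coefficient G S f (replicate k g ++ gs) (fsum f P)
      ≡⟨ coefficient-++ k g gs (fsum f P) ⟩
    coefficient G S f gs (fsum f P) ℤ.+ + k ℤ.* 𝔼g g (fsum f P)
      ≡⟨ cong (λ z → coefficient G S f gs (fsum f P) ℤ.+ + k ℤ.* z) vanishes ⟩
    coefficient G S f gs (fsum f P) ℤ.+ + k ℤ.* + 0
      ≡⟨ cong (λ z → coefficient G S f gs (fsum f P) ℤ.+ z) (ℤP.*-zeroʳ (+ k)) ⟩
    coefficient G S f gs (fsum f P) ℤ.+ + 0
      ≡⟨ ℤP.+-identityʳ _ ⟩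
    coefficient G S f gs (fsum f P)
      ≡⟨ correct P P⊆S 2≤P D<fP ⟩
    c (fsum f P) ∎
    where
    open ≡-Reasoning
    vanishes : 𝔼g g (fsum f P) ≡ + 0
    vanishes = trans (𝔼g≡ (fsum f P) D≤fP) (trans (cong (s ℤ.*_) (δ-< D<fP)) (ℤP.*-zeroʳ s))
  ... | inj₂ refl = begin
    coefficient G S f (replicate k g ++ gs) D  ≡⟨ coefficient-++ k g gs D ⟩
    coefficient G S f gs D ℤ.+ + k ℤ.* 𝔼g g D ≡⟨ cong (λ z → coefficient G S f gs D ℤ.+ + k ℤ.* z) atD ⟩
    coefficient G S f gs D ℤ.+ + k ℤ.* s      ≡⟨ fixed ⟩
    c D                                        ∎
    where
    open ≡-Reasoning
    atD : 𝔼g g D ≡ s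
    atD = trans (𝔼g≡ D ℕP.≤-refl) (trans (cong (s ℤ.*_) (δ-refl D)) (ℤP.*-identityʳ s))

  fix-degree : ∀ {D gs} T → Realises D T → CorrectFrom (suc D) gs → ∃ (CorrectFrom D)
  fix-degree {D} {gs} T (T⊆S , 2≤T , fT≡D) correct = adjust (c D - coefficient G S f gs D) refl
    where
    r : Fin n
    r = proj₁ (card-≥1⇒∃ T (ℕP.≤-trans (s≤s z≤n) 2≤T))
    Tr : T r ≡ true
    Tr = proj₂ (card-≥1⇒∃ T (ℕP.≤-trans (s≤s z≤n) 2≤T))
    positive negative : Gadget S
    positive = positiveGadget T⊆S Tr
    negative = negativeGadget T⊆S Tr
    above : ∀ {j} → D ≤ j → fsum f T ≤ j
    above D≤j = subst (_≤ _) (sym fT≡D) D≤j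
    raises : ∀ j → D ≤ j → 𝔼g positive j ≡ + 1 ℤ.* δ D j
    raises j D≤j = trans (𝔼-positiveGadget T⊆S Tr f f≥1 2≤T j (above D≤j))
                         (trans (cong (λ k → δ k j) fT≡D) (sym (ℤP.*-identityˡ _)))
    lowers : ∀ j → D ≤ j → 𝔼g negative j ≡ -1ℤ ℤ.* δ D j
    lowers j D≤j = trans (𝔼-negativeGadget T⊆S Tr f f≥1 2≤T j (above D≤j))
                         (trans (cong (λ k → - δ k j) fT≡D) (sym (ℤP.-1*i≡-i _)))
    closes : ∀ {x} → x ≡ c D - coefficient G S f gs D → coefficient G S f gs D ℤ.+ x ≡ c D
    closes refl = solve 2 (λ a b → a :+ (b :- a) := b) refl (coefficient G S f gs D) (c D)
    adjust : ∀ d → c D - coefficient G S f gs D ≡ d → ∃ (CorrectFrom D)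
    adjust (+ k)    gap = replicate k positive ++ gs ,
      add-copies k positive (+ 1) raises (closes (trans (ℤP.*-identityʳ (+ k)) (sym gap))) correct
    adjust -[1+ k ] gap = replicate (suc k) negative ++ gs ,
      add-copies (suc k) negative -1ℤ lowers (closes (trans (trans (ℤP.*-comm (+ suc k) -1ℤ) (ℤP.-1*i≡-i _)) (sym gap))) correct

  lower : ∀ {D} → ∃ (CorrectFrom (suc D)) → ∃ (CorrectFrom D)
  lower {D} (gs , correct) with realises? D
  ... | yes (T , realised) = fix-degree {gs = gs} T realised correct
  ... | no none = gs , correct′
    where
    correct′ : CorrectFrom D gs
    correct′ P P⊆S 2≤P D≤fP with ℕP.m≤n⇒m<n∨m≡n D≤fP
    ... | inj₁ D<fP = correct P P⊆S 2≤P D<fP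
    ... | inj₂ D≡fP = contradiction (P , P⊆S , 2≤P , sym D≡fP) none

  correct-above : ∀ t D → fsum f S < t + D → ∃ (CorrectFrom D)
  correct-above zero    D fS<D =
    [] , λ P P⊆S _ D≤fP → contradiction (ℕP.≤-<-trans (fsum-mono f P S P⊆S) fS<D) (ℕP.≤⇒≯ D≤fP)
  correct-above (suc t) D fS<t+D = lower (correct-above t (suc D) (subst (fsum f S <_) (sym (ℕP.+-suc t D)) fS<t+D))

  correct-everywhere : ∃ (CorrectFrom 0)
  correct-everywhere = correct-above (suc (fsum f S)) 0 (subst (fsum f S <_) (sym (ℕP.+-identityʳ _)) ℕP.≤-refl)

theorem2p6 : ∀ {n} (G : Graph n) (S : VSet n) (f : Fin n → ℕ) →
    (∀ s → S s ≡ true → 1 ≤ f s) →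
    (c : ℕ → ℤ) →
    Σ ℕ (λ m → Σ (Graph (n + m)) (λ G' →
    IsInducedExt G G' ×
    (∀ (S' : VSet n) → S' ⊆ᵥ S → 2 ≤ card S' →
    coeff (expectedObs G' (liftSet m S) (liftMult m f)) (fsum f S')
    ≡ c (fsum f S'))))
theorem2p6 {n} G S f f≥1 c = extraVertices n (length gs) , extended , extended-induced , λ S′ S′⊆S 2≤S′ →
  trans (coeff-extended G S f gs (fsum f S′)) (correct S′ S′⊆S 2≤S′ z≤n)
  where
  gs : List (Gadget S)
  gs = proj₁ (correct-everywhere G S f f≥1 c)
  correct : CorrectFrom G S f f≥1 c 0 gs
  correct = proj₂ (correct-everywhere G S f f≥1 c)
  open Extension G S gs
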